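{- Let $n\ge1$, $\pi\in B_n$ and let $a\ne b$ be elements of $\pi[n]$. Then $\alpha(a,a)+\alpha(a,b)+\alpha(b,b)\le 2$.
   Context: $B_n$ is the group of permutations $\pi$ of $[-n,n]\setminus\{0\}$ with $\pi(-i)=-\pi(i)$; $\pi[n]=\{\pi(1),\dots,\pi(n)\}$. Let $\ell$ be the length with respect to the generators $s_0=t_{1,-1}$, $s_i=t_{i,i+1}t_{ -i,-(i+1)}$ ($1\le i\le n-1$), $t_{x,y}$ the transposition of $x,y$. For distinct $x,y\in[-n,n]\setminus\{0\}$ define $u_{x,y}$: if $x=-y$, $u_{x,y}=t_{x,-x}$; if $xy>0$ or $\pi^{ -1}(x)\pi^{ -1}(y)>0$, $u_{x,y}=t_{x,y}t_{ -x,-y}$; otherwise $u_{x,y}$ is undefined. The graph $\Gamma_-^B(\pi)$ has vertex set $[-n,n]\setminus\{0\}$, with $\{x,y\}$ an edge iff $u_{x,y}$ is defined and $\ell(u_{x,y}\pi)=\ell(\pi)-1$. Set $e(x,y)=1$ if $x,y$ are adjacent and $0$ otherwise, $e(x,x)=0$. For $x,y\in\pi[n]$ let $\alpha(x,y)=e(x,y)+e(x,-y)$. -}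

module Defs where

open import Data.Nat using (ℕ; zero; suc; _+_; _≤_)
open import Data.Fin using (Fin; zero; suc; inject₁)
import Data.Fin.Properties as FinP
open import Data.List using (List; []; _∷_; length)
open import Data.Product using (Σ; ∃; _×_; _,_)
open import Data.Sum using (_⊎_)
open import Relation.Nullary using (¬_; Dec; yes; no)
open import Relation.Binary.PropositionalEquality using (_≡_; _≢_; refl)

-- The set [-n,n] \ {0}:  pos i  stands for  i+1,  neg i  for  -(i+1)
-- (i : Fin n, so i+1 ranges over 1..n).

data Elem (n : ℕ) : Set where
  pos : Fin n → Elem n
  neg : Fin n → Elem n

minus : ∀ {n} → Elem n → Elem n
minus (pos i) = neg i
minus (neg i) = pos i

data SameSign {n : ℕ} : Elem n → Elem n → Set where
  pp : ∀ i j → SameSign (pos i) (pos j)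
  nn : ∀ i j → SameSign (neg i) (neg j)

_≟E_ : ∀ {n} (x y : Elem n) → Dec (x ≡ y)
pos i ≟E pos j with FinP._≟_ i j
... | yes refl = yes refl
... | no ne = no λ { refl → ne refl }
neg i ≟E neg j with FinP._≟_ i j
... | yes refl = yes refl
... | no ne = no λ { refl → ne refl }
pos i ≟E neg j = no λ ()
neg i ≟E pos j = no λ ()

-- The hyperoctahedral group B_n: permutations π of [-n,n]\{0}
-- with π(-i) = -π(i).  Group elements are compared pointwise.

record SignedPerm (n : ℕ) : Set where
  field
    fun   : Elem n → Elem n
    inv   : Elem n → Elem n
    inv-l : ∀ x → inv (fun x) ≡ x
    inv-r : ∀ x → fun (inv x) ≡ x
    odd   : ∀ x → fun (minus x) ≡ minus (fun x)
open SignedPerm public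

-- π[n] = {π(1),...,π(n)}
_∈Img_ : ∀ {n} → Elem n → SignedPerm n → Set
_∈Img_ {n} a π = Σ (Fin n) λ i → fun π (pos i) ≡ a

transp : ∀ {n} → Elem n → Elem n → Elem n → Elem n
transp x y z with z ≟E x
... | yes _ = y
... | no _ with z ≟E y
...   | yes _ = x
...   | no _ = z

_∘E_ : ∀ {n} → (Elem n → Elem n) → (Elem n → Elem n) → Elem n → Elem n
(f ∘E g) z = f (g z)

-- Coxeter generators of B_n, indexed by k : Fin n (k = 0,...,n-1):
--   s_0 = t_{1,-1},   s_k = t_{k,k+1} t_{-k,-(k+1)}  (1 ≤ k ≤ n-1).
gen : ∀ {n} → Fin n → Elem n → Elem n
gen {suc m} zero = transp (pos zero) (neg zero)
gen {suc m} (suc j) =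
  transp (pos (inject₁ j)) (pos (suc j)) ∘E transp (neg (inject₁ j)) (neg (suc j))

evalWord : ∀ {n} → List (Fin n) → Elem n → Elem n
evalWord [] z = z
evalWord (k ∷ w) z = gen k (evalWord w z)

Represents : ∀ {n} → List (Fin n) → (Elem n → Elem n) → Set
Represents w f = ∀ z → evalWord w z ≡ f z

HasLength : ∀ {n} → (Elem n → Elem n) → ℕ → Set
HasLength {n} f k =
  (Σ (List (Fin n)) λ w → length w ≡ k × Represents w f)
  × (∀ (w : List (Fin n)) → Represents w f → k ≤ length w)

-- u_{x,y} (relative to π):  U π x y u  means "u_{x,y} is defined and equals u".

data U {n : ℕ} (π : SignedPerm n) (x y : Elem n) : (Elem n → Elem n) → Set where
  u-neg  : y ≡ minus x → U π x y (transp x (minus x))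
  u-same : x ≢ minus y → SameSign x y →
           U π x y (transp x y ∘E transp (minus x) (minus y))
  u-preimage : x ≢ minus y → SameSign (inv π x) (inv π y) →
           U π x y (transp x y ∘E transp (minus x) (minus y))

-- Edge {x,y} of Γ_-^B(π):  x ≠ y, u_{x,y} defined, and ℓ(u_{x,y} π) = ℓ(π) - 1.
Edge : ∀ {n} → SignedPerm n → Elem n → Elem n → Set
Edge π x y =
  x ≢ y × Σ _ λ u → U π x y u ×
    Σ ℕ λ k → HasLength (u ∘E fun π) k × HasLength (fun π) (suc k)

-- e(x,y) = k  (k ∈ {0,1}):  e(x,x) = 0;  for x ≠ y, e(x,y) = 1 iff adjacent.
data EVal {n : ℕ} (π : SignedPerm n) (x y : Elem n) : ℕ → Set where
  e-diag : x ≡ y → EVal π x y 0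
  e-adj  : x ≢ y → Edge π x y → EVal π x y 1
  e-non  : x ≢ y → ¬ Edge π x y → EVal π x y 0

AlphaVal : ∀ {n} → SignedPerm n → Elem n → Elem n → ℕ → Set
AlphaVal π x y k =
  Σ ℕ λ k₁ → Σ ℕ λ k₂ → EVal π x y k₁ × EVal π x (minus y) k₂ × k ≡ k₁ + k₂

-- Let dlen π count the inversions of π on all of [-n,n]∖{0} plus the p > 0 with π p < 0.
-- Every generator changes dlen by ±2 and, unless π = 1, some generator lowers it; hence dlen = 2ℓ,
-- and an edge {x,y} of Γ₋ is a reflection u with dlen (u π) = dlen π - 2.  Explicit formulas for
-- dlen after t_{x,-x} and after t_{x,y} t_{-x,-y} show, for a and b with positive preimages, that
-- {a,-a} is an edge only if a < 0, that {a,b} and {a,-b} are edges only if the swap reverses the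
-- order of the values as well as of their preimages ({a,-b} moreover needs a and b of opposite
-- signs), and that t_{x,-x} lowers the length by at least three as soon as some z and -z lie between
-- x and -x both in value and in preimage.  These constraints rule out any three of the four edges
-- {a,-a}, {b,-b}, {a,b}, {a,-b}, which are exactly what α(a,a) + α(a,b) + α(b,b) counts.
module Submission where

open import Data.Nat using (ℕ; zero; suc)
open import Data.Fin using (Fin; zero; suc; toℕ; inject₁; lower₁)
import Data.Fin.Properties as FinP
open import Data.List using (List; []; _∷_; length)
open import Data.Product using (Σ; _×_; _,_; proj₁)
open import Data.Sum using (_⊎_; inj₁; inj₂)
open import Data.Empty using (⊥; ⊥-elim)
open import Function using (_∘′_)
open import Relation.Nullary using (¬_; Dec; yes; no)
open import Relation.Binary using (tri<; tri≈; tri>)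
open import Relation.Binary.PropositionalEquality

open import Defs

private variable n : ℕ

minus-involutive : (u : Elem n) → minus (minus u) ≡ u
minus-involutive (pos i) = refl
minus-involutive (neg i) = refl

minus-injective : {u v : Elem n} → minus u ≡ minus v → u ≡ v
minus-injective {u = u} {v} e =
  trans (sym (minus-involutive u)) (trans (cong minus e) (minus-involutive v))

u≢minus-u : (u : Elem n) → u ≢ minus u
u≢minus-u (pos i) ()
u≢minus-u (neg i) ()

inv-odd : (π : SignedPerm n) (v : Elem n) → inv π (minus v) ≡ minus (inv π v)
inv-odd π v = begin
  inv π (minus v)                  ≡⟨ cong (inv π ∘′ minus) (sym (inv-r π v)) ⟩
  inv π (minus (fun π (inv π v)))  ≡⟨ cong (inv π) (sym (odd π (inv π v))) ⟩
  inv π (fun π (minus (inv π v)))  ≡⟨ inv-l π _ ⟩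
  minus (inv π v)                  ∎
  where open ≡-Reasoning

inv-injective : (π : SignedPerm n) {u v : Elem n} → inv π u ≡ inv π v → u ≡ v
inv-injective π {u} {v} e = trans (sym (inv-r π u)) (trans (cong (fun π) e) (inv-r π v))

transp-at₁ : (x y : Elem n) → transp x y x ≡ y
transp-at₁ x y with x ≟E x
... | yes _ = refl
... | no x≢x = ⊥-elim (x≢x refl)

transp-at₂ : (x y : Elem n) → transp x y y ≡ x
transp-at₂ x y with y ≟E x
... | yes y≡x = y≡x
... | no _ with y ≟E y
...   | yes _ = refl
...   | no y≢y = ⊥-elim (y≢y refl)

transp-fix : (x y z : Elem n) → z ≢ x → z ≢ y → transp x y z ≡ z
transp-fix x y z z≢x z≢y with z ≟E x
... | yes z≡x = ⊥-elim (z≢x z≡x)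
... | no _ with z ≟E y
...   | yes z≡y = ⊥-elim (z≢y z≡y)
...   | no _ = refl

data TranspView (x y v : Elem n) : Set where
  at₁   : v ≡ x → transp x y v ≡ y → TranspView x y v
  at₂   : v ≡ y → transp x y v ≡ x → TranspView x y v
  fixed : v ≢ x → v ≢ y → transp x y v ≡ v → TranspView x y v

transpView : (x y v : Elem n) → TranspView x y v
transpView x y v with v ≟E x
... | yes refl = at₁ refl (transp-at₁ x y)
... | no v≢x with v ≟E y
...   | yes refl = at₂ refl (transp-at₂ x y)
...   | no v≢y = fixed v≢x v≢y (transp-fix x y v v≢x v≢y)

transp-sym : (x y v : Elem n) → transp x y v ≡ transp y x v
transp-sym x y v with transpView x y v
... | at₁ refl e = trans e (sym (transp-at₂ y v))
... | at₂ refl e = trans e (sym (transp-at₁ v x))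
... | fixed v≢x v≢y e = trans e (sym (transp-fix y x v v≢y v≢x))

transp-involutive : (x y v : Elem n) → transp x y (transp x y v) ≡ v
transp-involutive x y v with transpView x y v
... | at₁ refl e rewrite e = transp-at₂ v y
... | at₂ refl e rewrite e = transp-at₁ x v
... | fixed _ _ e rewrite e = e

transp-minus : (x y v : Elem n) →
  transp x y (minus v) ≡ minus (transp (minus x) (minus y) v)
transp-minus x y v with transpView (minus x) (minus y) v
... | at₁ refl e = begin
  transp x y (minus (minus x))  ≡⟨ cong (transp x y) (minus-involutive x) ⟩
  transp x y x                  ≡⟨ transp-at₁ x y ⟩
  y                             ≡⟨ sym (minus-involutive y) ⟩
  minus (minus y)               ≡⟨ cong minus (sym e) ⟩
  minus (transp (minus x) (minus y) (minus x)) ∎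
  where open ≡-Reasoning
... | at₂ refl e = begin
  transp x y (minus (minus y))  ≡⟨ cong (transp x y) (minus-involutive y) ⟩
  transp x y y                  ≡⟨ transp-at₂ x y ⟩
  x                             ≡⟨ sym (minus-involutive x) ⟩
  minus (minus x)               ≡⟨ cong minus (sym e) ⟩
  minus (transp (minus x) (minus y) (minus y)) ∎
  where open ≡-Reasoning
... | fixed v≢-x v≢-y e =
  trans (transp-fix x y (minus v) (λ h → v≢-x (minus-moved h)) (λ h → v≢-y (minus-moved h)))
        (sym (cong minus e))
  where
  minus-moved : ∀ {w} → minus v ≡ w → v ≡ minus w
  minus-moved h = trans (sym (minus-involutive v)) (cong minus h)

transp-commute : (x y u v z : Elem n) → x ≢ u → x ≢ v → y ≢ u → y ≢ v →
  transp x y (transp u v z) ≡ transp u v (transp x y z)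
transp-commute x y u v z x≢u x≢v y≢u y≢v with transpView u v z | transpView x y z
... | at₁ refl _ | at₁ refl _ = ⊥-elim (x≢u refl)
... | at₁ refl _ | at₂ refl _ = ⊥-elim (y≢u refl)
... | at₂ refl _ | at₁ refl _ = ⊥-elim (x≢v refl)
... | at₂ refl _ | at₂ refl _ = ⊥-elim (y≢v refl)
... | at₁ refl e | fixed _ _ e′ rewrite e | e′ =
  trans (transp-fix x y v (x≢v ∘′ sym) (y≢v ∘′ sym)) (sym (transp-at₁ z v))
... | at₂ refl e | fixed _ _ e′ rewrite e | e′ =
  trans (transp-fix x y u (x≢u ∘′ sym) (y≢u ∘′ sym)) (sym (transp-at₂ u z))
... | fixed _ _ e | at₁ refl e′ rewrite e | e′ = sym (transp-fix u v y y≢u y≢v)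
... | fixed _ _ e | at₂ refl e′ rewrite e | e′ = sym (transp-fix u v x x≢u x≢v)
... | fixed _ _ e | fixed _ _ e′ rewrite e | e′ = sym e

gen-involutive : (k : Fin n) (z : Elem n) → gen k (gen k z) ≡ z
gen-involutive {suc m} zero z = transp-involutive (pos zero) (neg zero) z
gen-involutive {suc m} (suc j) z = begin
  t₊ (t₋ (t₊ (t₋ z)))  ≡⟨ cong t₊ (transp-commute c d a b (t₋ z) (λ ()) (λ ()) (λ ()) (λ ())) ⟩
  t₊ (t₊ (t₋ (t₋ z)))  ≡⟨ transp-involutive a b _ ⟩
  t₋ (t₋ z)            ≡⟨ transp-involutive c d z ⟩
  z                    ∎
  where
  open ≡-Reasoning
  a b c d : Elem (suc m)
  a = pos (inject₁ j)
  b = pos (suc j)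
  c = neg (inject₁ j)
  d = neg (suc j)
  t₊ t₋ : Elem (suc m) → Elem (suc m)
  t₊ = transp a b
  t₋ = transp c d

gen-odd : (k : Fin n) (z : Elem n) → gen k (minus z) ≡ minus (gen k z)
gen-odd {suc m} zero z =
  trans (transp-minus (pos zero) (neg zero) z) (cong minus (transp-sym (neg zero) (pos zero) z))
gen-odd {suc m} (suc j) z = begin
  transp a b (transp c d (minus z))  ≡⟨ cong (transp a b) (transp-minus c d z) ⟩
  transp a b (minus (transp a b z))  ≡⟨ transp-minus a b (transp a b z) ⟩
  minus (transp c d (transp a b z))  ≡⟨ cong minus (transp-commute c d a b z (λ ()) (λ ()) (λ ()) (λ ())) ⟩
  minus (transp a b (transp c d z))  ∎
  where
  open ≡-Reasoning
  a b c d : Elem (suc m)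
  a = pos (inject₁ j)
  b = pos (suc j)
  c = neg (inject₁ j)
  d = neg (suc j)

genSP : Fin n → SignedPerm n
genSP k = record
  { fun = gen k ; inv = gen k ; inv-l = gen-involutive k ; inv-r = gen-involutive k ; odd = gen-odd k }

idSP : SignedPerm n
idSP = record
  { fun = λ z → z ; inv = λ z → z ; inv-l = λ _ → refl ; inv-r = λ _ → refl ; odd = λ _ → refl }

_∘SP_ : SignedPerm n → SignedPerm n → SignedPerm n
σ ∘SP τ = record
  { fun = λ z → fun σ (fun τ z)
  ; inv = λ z → inv τ (inv σ z)
  ; inv-l = λ z → trans (cong (inv τ) (inv-l σ (fun τ z))) (inv-l τ z)
  ; inv-r = λ z → trans (cong (fun σ) (inv-r τ (inv σ z))) (inv-r σ z)
  ; odd = λ z → trans (cong (fun σ) (odd τ z)) (odd σ (fun τ z))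
  }

wordSP : List (Fin n) → SignedPerm n
wordSP [] = idSP
wordSP (k ∷ w) = genSP k ∘SP wordSP w

wordSP-represents : (w : List (Fin n)) → Represents w (fun (wordSP w))
wordSP-represents [] z = refl
wordSP-represents (k ∷ w) z = cong (gen k) (wordSP-represents w z)

-- Integer arithmetic is opened only inside this block, so that _+_ and _≤_ in the theorem are those of ℕ.
module _ where
  open import Data.Nat as ℕ using (z≤n; s≤s)
  import Data.Nat.Properties as ℕP
  open import Data.Integer
    using (ℤ; +_; -[1+_]; ∣_∣; _+_; _*_; -_; _-_; _<_; _≤_; _<?_; _≤?_; +<+; -<-; -<+; +≤+; -≤+)
  import Data.Integer.Properties as ℤP
  open import Data.Integer.Tactic.RingSolver using (solve-∀)
  open import Relation.Nullary.Decidable using (True; toWitness)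

  𝟙 : {P : Set} → Dec P → ℤ
  𝟙 (yes _) = + 1
  𝟙 (no _) = + 0

  χ< : ℤ → ℤ → ℤ
  χ< a b = 𝟙 (a <? b)

  χ<-yes : ∀ {a b} → a < b → χ< a b ≡ + 1
  χ<-yes {a} {b} a<b with a <? b
  ... | yes _ = refl
  ... | no a≮b = ⊥-elim (a≮b a<b)

  χ<-no : ∀ {a b} → ¬ (a < b) → χ< a b ≡ + 0
  χ<-no {a} {b} a≮b with a <? b
  ... | yes a<b = ⊥-elim (a≮b a<b)
  ... | no _ = refl

  χ<≡1⇒< : ∀ {a b} → χ< a b ≡ + 1 → a < b
  χ<≡1⇒< {a} {b} e with a <? b
  ... | yes a<b = a<b
  ... | no _ with e
  ...   | ()

  χ<-neg : ∀ a b → χ< (- a) (- b) ≡ χ< b a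
  χ<-neg a b with b <? a
  ... | yes b<a = χ<-yes (ℤP.neg-mono-< b<a)
  ... | no b≮a = χ<-no (b≮a ∘′ ℤP.neg-cancel-<)

  χ<-noneBetween : ∀ a c b → (a < c → c < b → ⊥) → χ< a c * χ< c b ≡ + 0
  χ<-noneBetween a c b h with a <? c
  ... | no _ = refl
  ... | yes a<c with c <? b
  ...   | no _ = refl
  ...   | yes c<b = ⊥-elim (h a<c c<b)

  IsBit : ℤ → Set
  IsBit x = x ≡ + 0 ⊎ x ≡ + 1

  χ<-bit : ∀ a b → IsBit (χ< a b)
  χ<-bit a b with a <? b
  ... | yes _ = inj₂ refl
  ... | no _ = inj₁ refl

  bit-* : ∀ {x y} → IsBit x → IsBit y → IsBit (x * y)
  bit-* (inj₁ refl) _ = inj₁ refl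
  bit-* (inj₂ refl) (inj₁ refl) = inj₁ refl
  bit-* (inj₂ refl) (inj₂ refl) = inj₂ refl

  bit-nonNeg : ∀ {x} → IsBit x → + 0 ≤ x
  bit-nonNeg (inj₁ refl) = ℤP.≤-refl
  bit-nonNeg (inj₂ refl) = +≤+ z≤n

  bit-diff≤1 : ∀ {a b} → IsBit a → IsBit b → a - b ≤ + 1
  bit-diff≤1 (inj₁ refl) (inj₁ refl) = +≤+ z≤n
  bit-diff≤1 (inj₁ refl) (inj₂ refl) = -≤+
  bit-diff≤1 (inj₂ refl) (inj₁ refl) = +≤+ (s≤s z≤n)
  bit-diff≤1 (inj₂ refl) (inj₂ refl) = +≤+ z≤n

  decided : ∀ {a b} → {True (a ≤? b)} → a ≤ b
  decided {a} {b} {t} = toWitness t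

  bit-diffProduct≥-1 : ∀ {a b c d} → IsBit a → IsBit b → IsBit c → IsBit d → - + 1 ≤ (a - b) * (c - d)
  bit-diffProduct≥-1 (inj₁ refl) (inj₁ refl) _ _ = decided
  bit-diffProduct≥-1 (inj₂ refl) (inj₂ refl) _ _ = decided
  bit-diffProduct≥-1 (inj₁ refl) (inj₂ refl) (inj₁ refl) (inj₁ refl) = decided
  bit-diffProduct≥-1 (inj₁ refl) (inj₂ refl) (inj₁ refl) (inj₂ refl) = decided
  bit-diffProduct≥-1 (inj₁ refl) (inj₂ refl) (inj₂ refl) (inj₁ refl) = decided
  bit-diffProduct≥-1 (inj₁ refl) (inj₂ refl) (inj₂ refl) (inj₂ refl) = decided
  bit-diffProduct≥-1 (inj₂ refl) (inj₁ refl) (inj₁ refl) (inj₁ refl) = decided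
  bit-diffProduct≥-1 (inj₂ refl) (inj₁ refl) (inj₁ refl) (inj₂ refl) = decided
  bit-diffProduct≥-1 (inj₂ refl) (inj₁ refl) (inj₂ refl) (inj₁ refl) = decided
  bit-diffProduct≥-1 (inj₂ refl) (inj₁ refl) (inj₂ refl) (inj₂ refl) = decided

  toℤ : Elem n → ℤ
  toℤ (pos i) = + suc (toℕ i)
  toℤ (neg i) = -[1+ toℕ i ]

  toℤ-injective : {u v : Elem n} → toℤ u ≡ toℤ v → u ≡ v
  toℤ-injective {u = pos i} {pos j} e = cong pos (FinP.toℕ-injective (ℤP.+[1+-injective e))
  toℤ-injective {u = neg i} {neg j} e = cong neg (FinP.toℕ-injective (ℤP.-[1+-injective e))
  toℤ-injective {u = pos i} {neg j} ()
  toℤ-injective {u = neg i} {pos j} ()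

  toℤ-minus : (u : Elem n) → toℤ (minus u) ≡ - toℤ u
  toℤ-minus (pos i) = refl
  toℤ-minus (neg i) = refl

  toℤ≢0 : (u : Elem n) → toℤ u ≢ + 0
  toℤ≢0 (pos i) ()
  toℤ≢0 (neg i) ()

  toℤ≤n : (u : Elem n) → toℤ u ≤ + n
  toℤ≤n (pos i) = +≤+ (FinP.toℕ<n i)
  toℤ≤n (neg i) = -≤+

  χ<ᴱ : Elem n → Elem n → ℤ
  χ<ᴱ u v = χ< (toℤ u) (toℤ v)

  χpos χneg : Elem n → ℤ
  χpos u = χ< (+ 0) (toℤ u)
  χneg u = χ< (toℤ u) (+ 0)

  χ<ᴱ-irrefl : (u : Elem n) → χ<ᴱ u u ≡ + 0
  χ<ᴱ-irrefl u = χ<-no (ℤP.<-irrefl refl)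

  χ<ᴱ-bit : (u v : Elem n) → IsBit (χ<ᴱ u v)
  χ<ᴱ-bit u v = χ<-bit (toℤ u) (toℤ v)

  χpos-bit : (u : Elem n) → IsBit (χpos u)
  χpos-bit u = χ<-bit (+ 0) (toℤ u)

  χneg-bit : (u : Elem n) → IsBit (χneg u)
  χneg-bit u = χ<-bit (toℤ u) (+ 0)

  χ<ᴱ-minus : (u v : Elem n) → χ<ᴱ (minus u) (minus v) ≡ χ<ᴱ v u
  χ<ᴱ-minus u v rewrite toℤ-minus u | toℤ-minus v = χ<-neg (toℤ u) (toℤ v)

  χpos-minus : (u : Elem n) → χpos (minus u) ≡ χneg u
  χpos-minus u rewrite toℤ-minus u = χ<-neg (+ 0) (toℤ u)

  χpos+χneg : (u : Elem n) → χpos u + χneg u ≡ + 1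
  χpos+χneg u with ℤP.<-cmp (+ 0) (toℤ u)
  ... | tri< 0<u _ _ rewrite χ<-yes 0<u | χ<-no (ℤP.<-asym 0<u) = refl
  ... | tri≈ _ 0≡u _ = ⊥-elim (toℤ≢0 u (sym 0≡u))
  ... | tri> _ _ u<0 rewrite χ<-yes u<0 | χ<-no (ℤP.<-asym u<0) = refl

  χneg-minus : (u : Elem n) → χneg (minus u) ≡ χpos u
  χneg-minus u rewrite toℤ-minus u = χ<-neg (toℤ u) (+ 0)

  χneg≡1-χpos : (u : Elem n) → χneg u ≡ + 1 - χpos u
  χneg≡1-χpos u = begin
    χneg u                     ≡⟨ add-sub (χpos u) (χneg u) ⟩
    χpos u + χneg u - χpos u   ≡⟨ cong (_- χpos u) (χpos+χneg u) ⟩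
    + 1 - χpos u               ∎
    where
    open ≡-Reasoning
    add-sub : ∀ a b → b ≡ a + b - a
    add-sub = solve-∀

  χpos-pos : (i : Fin n) → χpos (pos i) ≡ + 1
  χpos-pos {n} i = χ<-yes {+ 0} {toℤ (pos {n} i)} (+<+ (s≤s z≤n))

  χ<ᴱ-minus-self : (u : Elem n) → χ<ᴱ (minus u) u ≡ χpos u
  χ<ᴱ-minus-self u rewrite toℤ-minus u with ℤP.<-cmp (+ 0) (toℤ u)
  ... | tri< 0<u _ _ = trans (χ<-yes (ℤP.<-trans (ℤP.neg-mono-< 0<u) 0<u)) (sym (χ<-yes 0<u))
  ... | tri≈ _ 0≡u _ = ⊥-elim (toℤ≢0 u (sym 0≡u))
  ... | tri> _ _ u<0 = trans (χ<-no (ℤP.<-asym (ℤP.<-trans u<0 (ℤP.neg-mono-< u<0))))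
                             (sym (χ<-no (ℤP.<-asym u<0)))

  χ<ᴱ-emptyInterval : (A B q : Elem n) → toℤ A < toℤ B → χ<ᴱ B q * χ<ᴱ q A ≡ + 0
  χ<ᴱ-emptyInterval A B q A<B = χ<-noneBetween (toℤ B) (toℤ q) (toℤ A) λ B<q q<A →
    ℤP.<-asym (ℤP.<-trans q<A A<B) B<q

  liftE : Elem n → Elem (suc n)
  liftE (pos i) = pos (suc i)
  liftE (neg i) = neg (suc i)

  liftE-injective : {u v : Elem n} → liftE u ≡ liftE v → u ≡ v
  liftE-injective {u = pos i} {pos .i} refl = refl
  liftE-injective {u = neg i} {neg .i} refl = refl

  liftE≢pos0 : (u : Elem n) → liftE u ≢ pos zero
  liftE≢pos0 (pos i) ()
  liftE≢pos0 (neg i) ()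

  liftE≢neg0 : (u : Elem n) → liftE u ≢ neg zero
  liftE≢neg0 (pos i) ()
  liftE≢neg0 (neg i) ()

  ΣE : (Elem n → ℤ) → ℤ
  ΣE {zero} h = + 0
  ΣE {suc n} h = h (pos zero) + h (neg zero) + ΣE (λ u → h (liftE u))

  ΣE-cong : {h h′ : Elem n → ℤ} → (∀ u → h u ≡ h′ u) → ΣE h ≡ ΣE h′
  ΣE-cong {zero} e = refl
  ΣE-cong {suc n} e = cong₂ _+_ (cong₂ _+_ (e _) (e _)) (ΣE-cong (λ u → e (liftE u)))

  ΣE-zero : {h : Elem n → ℤ} → (∀ u → h u ≡ + 0) → ΣE h ≡ + 0
  ΣE-zero {zero} e = refl
  ΣE-zero {suc n} e = cong₂ _+_ (cong₂ _+_ (e _) (e _)) (ΣE-zero (λ u → e (liftE u)))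

  ΣE-+ : (h h′ : Elem n → ℤ) → ΣE (λ u → h u + h′ u) ≡ ΣE h + ΣE h′
  ΣE-+ {zero} h h′ = refl
  ΣE-+ {suc n} h h′ rewrite ΣE-+ (λ u → h (liftE u)) (λ u → h′ (liftE u)) =
    shuffle (h (pos zero)) (h′ (pos zero)) (h (neg zero)) (h′ (neg zero)) _ _
    where
    shuffle : ∀ a b c d e f → a + b + (c + d) + (e + f) ≡ a + c + e + (b + d + f)
    shuffle = solve-∀

  ΣE-* : (c : ℤ) (h : Elem n → ℤ) → ΣE (λ u → c * h u) ≡ c * ΣE h
  ΣE-* {zero} c h = sym (ℤP.*-zeroʳ c)
  ΣE-* {suc n} c h rewrite ΣE-* c (λ u → h (liftE u)) =
    distrib c (h (pos zero)) (h (neg zero)) _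
    where
    distrib : ∀ c a b e → c * a + c * b + c * e ≡ c * (a + b + e)
    distrib = solve-∀

  ΣE-+- : (h h′ h″ : Elem n → ℤ) → ΣE (λ u → h u + h′ u - h″ u) ≡ ΣE h + ΣE h′ - ΣE h″
  ΣE-+- h h′ h″ = begin
    ΣE (λ u → h u + h′ u - h″ u)
      ≡⟨ ΣE-cong (λ u → sub (h u + h′ u) (h″ u)) ⟩
    ΣE (λ u → (h u + h′ u) + - + 1 * h″ u)
      ≡⟨ ΣE-+ (λ u → h u + h′ u) (λ u → - + 1 * h″ u) ⟩
    ΣE (λ u → h u + h′ u) + ΣE (λ u → - + 1 * h″ u)
      ≡⟨ cong₂ _+_ (ΣE-+ h h′) (ΣE-* (- + 1) h″) ⟩
    ΣE h + ΣE h′ + - + 1 * ΣE h″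
      ≡⟨ sym (sub (ΣE h + ΣE h′) (ΣE h″)) ⟩
    ΣE h + ΣE h′ - ΣE h″ ∎
    where
    open ≡-Reasoning
    sub : ∀ x y → x - y ≡ x + - + 1 * y
    sub = solve-∀

  ΣE-mono : {h h′ : Elem n → ℤ} → (∀ u → h u ≤ h′ u) → ΣE h ≤ ΣE h′
  ΣE-mono {zero} e = ℤP.≤-refl
  ΣE-mono {suc n} e = ℤP.+-mono-≤ (ℤP.+-mono-≤ (e _) (e _)) (ΣE-mono (λ u → e (liftE u)))

  ΣE-nonNeg : {h : Elem n → ℤ} → (∀ u → + 0 ≤ h u) → + 0 ≤ ΣE h
  ΣE-nonNeg {n} e = ℤP.≤-trans (ℤP.≤-reflexive (sym (ΣE-zero {n} λ _ → refl))) (ΣE-mono e)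

  mutual
    ΣE-single : (p : Elem n) (h : Elem n → ℤ) → (∀ u → u ≢ p → h u ≡ + 0) → ΣE h ≡ h p
    ΣE-single {suc n} (pos zero) h h0
      rewrite h0 (neg zero) (λ ()) | ΣE-zero (λ u → h0 (liftE u) (liftE≢pos0 u)) =
      trans (ℤP.+-identityʳ _) (ℤP.+-identityʳ _)
    ΣE-single {suc n} (neg zero) h h0
      rewrite h0 (pos zero) (λ ()) | ΣE-zero (λ u → h0 (liftE u) (liftE≢neg0 u)) =
      trans (ℤP.+-identityʳ _) (ℤP.+-identityˡ _)
    ΣE-single {suc n} (pos (suc i)) h h0 = ΣE-single-liftE (pos i) h h0
    ΣE-single {suc n} (neg (suc i)) h h0 = ΣE-single-liftE (neg i) h h0

    ΣE-single-liftE : (q : Elem n) (h : Elem (suc n) → ℤ) →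
      (∀ u → u ≢ liftE q → h u ≡ + 0) → ΣE h ≡ h (liftE q)
    ΣE-single-liftE q h h0
      rewrite h0 (pos zero) (liftE≢pos0 q ∘′ sym) | h0 (neg zero) (liftE≢neg0 q ∘′ sym) =
      trans (ℤP.+-identityˡ _)
            (ΣE-single q (λ u → h (liftE u)) λ u u≢q → h0 (liftE u) (u≢q ∘′ liftE-injective))

  𝟙≡ : Elem n → Elem n → ℤ
  𝟙≡ p u = 𝟙 (u ≟E p)

  𝟙≡-refl : (p : Elem n) → 𝟙≡ p p ≡ + 1
  𝟙≡-refl p with p ≟E p
  ... | yes _ = refl
  ... | no p≢p = ⊥-elim (p≢p refl)

  𝟙≡-≢ : (p u : Elem n) → u ≢ p → 𝟙≡ p u ≡ + 0
  𝟙≡-≢ p u u≢p with u ≟E p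
  ... | yes u≡p = ⊥-elim (u≢p u≡p)
  ... | no _ = refl

  ΣE-𝟙≡ : (p : Elem n) (h : Elem n → ℤ) → ΣE (λ u → 𝟙≡ p u * h u) ≡ h p
  ΣE-𝟙≡ p h =
    trans (ΣE-single p _ (λ u u≢p → cong (_* h u) (𝟙≡-≢ p u u≢p)))
          (trans (cong (_* h p) (𝟙≡-refl p)) (ℤP.*-identityˡ (h p)))

  module PairSupport {n : ℕ} (A B : Elem n) (A≢B : A ≢ B) where
    χ∈ : Elem n → ℤ
    χ∈ u = 𝟙≡ A u + 𝟙≡ B u

    ΣE-χ∈ : (h : Elem n → ℤ) → ΣE (λ u → χ∈ u * h u) ≡ h A + h B
    ΣE-χ∈ h = begin
      ΣE (λ u → χ∈ u * h u)
        ≡⟨ ΣE-cong (λ u → ℤP.*-distribʳ-+ (h u) (𝟙≡ A u) (𝟙≡ B u)) ⟩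
      ΣE (λ u → 𝟙≡ A u * h u + 𝟙≡ B u * h u)
        ≡⟨ ΣE-+ (λ u → 𝟙≡ A u * h u) (λ u → 𝟙≡ B u * h u) ⟩
      ΣE (λ u → 𝟙≡ A u * h u) + ΣE (λ u → 𝟙≡ B u * h u)
        ≡⟨ cong₂ _+_ (ΣE-𝟙≡ A h) (ΣE-𝟙≡ B h) ⟩
      h A + h B ∎
      where open ≡-Reasoning

    data Membership (u : Elem n) : Set where
      inside  : χ∈ u ≡ + 1 → Membership u
      outside : χ∈ u ≡ + 0 → u ≢ A → u ≢ B → Membership u

    membership : ∀ u → Membership u
    membership u with u ≟E A | u ≟E B
    ... | yes refl | _ = inside (cong₂ _+_ (𝟙≡-refl A) (𝟙≡-≢ B A A≢B))
    ... | no _ | yes refl = inside (cong₂ _+_ (𝟙≡-≢ A B (A≢B ∘′ sym)) (𝟙≡-refl B))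
    ... | no u≢A | no u≢B = outside (cong₂ _+_ (𝟙≡-≢ A u u≢A) (𝟙≡-≢ B u u≢B)) u≢A u≢B

    ΣE-supported : (h : Elem n → ℤ) → (∀ u → u ≢ A → u ≢ B → h u ≡ + 0) → ΣE h ≡ h A + h B
    ΣE-supported h h0 = trans (ΣE-cong restrict) (ΣE-χ∈ h)
      where
      restrict : ∀ u → h u ≡ χ∈ u * h u
      restrict u with membership u
      ... | inside e = sym (trans (cong (_* h u) e) (ℤP.*-identityˡ (h u)))
      ... | outside e u≢A u≢B = trans (h0 u u≢A u≢B) (sym (cong (_* h u) e))

    ΣE-≥-pair : (h : Elem n → ℤ) → (∀ u → + 0 ≤ h u) → h A + h B ≤ ΣE h
    ΣE-≥-pair h h≥0 = ℤP.≤-trans (ℤP.≤-reflexive (sym (ΣE-χ∈ h))) (ΣE-mono restrict)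
      where
      restrict : ∀ u → χ∈ u * h u ≤ h u
      restrict u with membership u
      ... | inside e = ℤP.≤-reflexive (trans (cong (_* h u) e) (ℤP.*-identityˡ (h u)))
      ... | outside e _ _ = ℤP.≤-trans (ℤP.≤-reflexive (cong (_* h u) e)) (h≥0 u)

    ΣE²-supported : (T : Elem n → Elem n → ℤ) →
      (∀ p q → p ≢ A → p ≢ B → q ≢ A → q ≢ B → T p q ≡ + 0) →
      ΣE (λ p → ΣE (T p)) ≡
      ΣE (λ q → T A q + T B q + (T q A + T q B)) - (T A A + T A B + (T B A + T B B))
    ΣE²-supported T T0 = begin
      ΣE (λ p → ΣE (T p))
        ≡⟨ ΣE-cong (λ p → ΣE-cong (restrict p)) ⟩
      ΣE (λ p → ΣE (λ q → χ∈ p * T p q + χ∈ q * T p q - χ∈ p * (χ∈ q * T p q)))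
        ≡⟨ ΣE-cong (λ p → ΣE-+- (λ q → χ∈ p * T p q) (λ q → χ∈ q * T p q)
                                (λ q → χ∈ p * (χ∈ q * T p q))) ⟩
      ΣE (λ p → ΣE (λ q → χ∈ p * T p q) + ΣE (λ q → χ∈ q * T p q)
                - ΣE (λ q → χ∈ p * (χ∈ q * T p q)))
        ≡⟨ ΣE-cong (λ p → cong₂ _-_ (cong₂ _+_ (ΣE-* (χ∈ p) (T p)) (ΣE-χ∈ (T p)))
                                     (trans (ΣE-* (χ∈ p) (λ q → χ∈ q * T p q))
                                            (cong (χ∈ p *_) (ΣE-χ∈ (T p))))) ⟩
      ΣE (λ p → χ∈ p * ΣE (T p) + (T p A + T p B) - χ∈ p * (T p A + T p B))
        ≡⟨ ΣE-+- (λ p → χ∈ p * ΣE (T p)) (λ p → T p A + T p B) (λ p → χ∈ p * (T p A + T p B)) ⟩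
      ΣE (λ p → χ∈ p * ΣE (T p)) + ΣE (λ p → T p A + T p B) - ΣE (λ p → χ∈ p * (T p A + T p B))
        ≡⟨ cong₂ _-_ (cong (_+ ΣE (λ p → T p A + T p B))
                           (trans (ΣE-χ∈ (λ p → ΣE (T p))) (sym (ΣE-+ (T A) (T B)))))
                     (ΣE-χ∈ (λ p → T p A + T p B)) ⟩
      ΣE (λ q → T A q + T B q) + ΣE (λ p → T p A + T p B) - (T A A + T A B + (T B A + T B B))
        ≡⟨ cong (_- (T A A + T A B + (T B A + T B B)))
                (sym (ΣE-+ (λ q → T A q + T B q) (λ q → T q A + T q B))) ⟩
      ΣE (λ q → T A q + T B q + (T q A + T q B)) - (T A A + T A B + (T B A + T B B)) ∎
      where
      open ≡-Reasoning
      restrict : ∀ p q → T p q ≡ χ∈ p * T p q + χ∈ q * T p q - χ∈ p * (χ∈ q * T p q)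
      restrict p q with membership p | membership q
      ... | inside e | _ rewrite e = rowIn (χ∈ q) (T p q)
        where
        rowIn : ∀ a t → t ≡ + 1 * t + a * t - + 1 * (a * t)
        rowIn = solve-∀
      ... | outside e _ _ | inside e′ rewrite e | e′ = columnIn (T p q)
        where
        columnIn : ∀ t → t ≡ + 0 * t + + 1 * t - + 0 * (+ 1 * t)
        columnIn = solve-∀
      ... | outside e p≢A p≢B | outside e′ q≢A q≢B rewrite e | e′ | T0 p q p≢A p≢B q≢A q≢B = refl

  χ<-enterBetween : ∀ X Y Z → X < Y → Z ≢ X → Z ≢ Y → χ< Z Y - χ< Z X ≡ χ< X Z * χ< Z Y
  χ<-enterBetween X Y Z X<Y Z≢X Z≢Y with ℤP.<-cmp Z X
  ... | tri< Z<X _ _ rewrite χ<-yes (ℤP.<-trans Z<X X<Y) | χ<-yes Z<X | χ<-no (ℤP.<-asym Z<X) = refl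
  ... | tri≈ _ Z≡X _ = ⊥-elim (Z≢X Z≡X)
  ... | tri> _ _ X<Z with ℤP.<-cmp Z Y
  ...   | tri< Z<Y _ _ rewrite χ<-yes Z<Y | χ<-yes X<Z | χ<-no (ℤP.<-asym X<Z) = refl
  ...   | tri≈ _ Z≡Y _ = ⊥-elim (Z≢Y Z≡Y)
  ...   | tri> _ _ Y<Z rewrite χ<-no (ℤP.<-asym Y<Z) | χ<-yes X<Z | χ<-no (ℤP.<-asym X<Z) = refl

  χ<-leaveBetween : ∀ X Y Z → X < Y → Z ≢ X → Z ≢ Y → χ< Y Z - χ< X Z ≡ - (χ< X Z * χ< Z Y)
  χ<-leaveBetween X Y Z X<Y Z≢X Z≢Y with ℤP.<-cmp Z X
  ... | tri< Z<X _ _ rewrite χ<-no (ℤP.<-asym (ℤP.<-trans Z<X X<Y)) | χ<-no (ℤP.<-asym Z<X) = refl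
  ... | tri≈ _ Z≡X _ = ⊥-elim (Z≢X Z≡X)
  ... | tri> _ _ X<Z with ℤP.<-cmp Z Y
  ...   | tri< Z<Y _ _ rewrite χ<-yes Z<Y | χ<-yes X<Z | χ<-no (ℤP.<-asym Z<Y) = refl
  ...   | tri≈ _ Z≡Y _ = ⊥-elim (Z≢Y Z≡Y)
  ...   | tri> _ _ Y<Z rewrite χ<-no (ℤP.<-asym Y<Z) | χ<-yes X<Z | χ<-yes Y<Z = refl

  χ<-crossing : ∀ A B Q → Q ≢ A → Q ≢ B →
    χ< A Q - χ< Q A - χ< B Q + χ< Q B ≡ + 2 * (χ< A Q * χ< Q B - χ< B Q * χ< Q A)
  χ<-crossing A B Q Q≢A Q≢B with ℤP.<-cmp Q A | ℤP.<-cmp Q B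
  ... | tri≈ _ Q≡A _ | _ = ⊥-elim (Q≢A Q≡A)
  ... | _ | tri≈ _ Q≡B _ = ⊥-elim (Q≢B Q≡B)
  ... | tri< Q<A _ _ | tri< Q<B _ _
    rewrite χ<-yes Q<A | χ<-yes Q<B | χ<-no (ℤP.<-asym Q<A) | χ<-no (ℤP.<-asym Q<B) = refl
  ... | tri< Q<A _ _ | tri> _ _ B<Q
    rewrite χ<-yes Q<A | χ<-yes B<Q | χ<-no (ℤP.<-asym Q<A) | χ<-no (ℤP.<-asym B<Q) = refl
  ... | tri> _ _ A<Q | tri< Q<B _ _
    rewrite χ<-yes A<Q | χ<-yes Q<B | χ<-no (ℤP.<-asym A<Q) | χ<-no (ℤP.<-asym Q<B) = refl
  ... | tri> _ _ A<Q | tri> _ _ B<Q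
    rewrite χ<-yes A<Q | χ<-yes B<Q | χ<-no (ℤP.<-asym A<Q) | χ<-no (ℤP.<-asym B<Q) = refl

  -- Exchanging the values X < Y at positions A and B changes the comparisons with a value Z
  -- at position Q only when Z lies between X and Y and Q between A and B.
  χ<-exchange : ∀ X Y Z A B Q → X < Y → Z ≢ X → Z ≢ Y → Q ≢ A → Q ≢ B →
    χ< A Q * (χ< Z Y - χ< Z X) + χ< B Q * (χ< Z X - χ< Z Y)
      + χ< Q A * (χ< Y Z - χ< X Z) + χ< Q B * (χ< X Z - χ< Y Z)
    ≡ + 2 * (χ< X Z * χ< Z Y) * (χ< A Q * χ< Q B - χ< B Q * χ< Q A)
  χ<-exchange X Y Z A B Q X<Y Z≢X Z≢Y Q≢A Q≢B = begin
    χ< A Q * (χ< Z Y - χ< Z X) + χ< B Q * (χ< Z X - χ< Z Y)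
      + χ< Q A * (χ< Y Z - χ< X Z) + χ< Q B * (χ< X Z - χ< Y Z)
      ≡⟨ regroup (χ< A Q) (χ< B Q) (χ< Q A) (χ< Q B) (χ< Z Y) (χ< Z X) (χ< Y Z) (χ< X Z) ⟩
    (χ< A Q - χ< Q A - χ< B Q + χ< Q B) * β
      + (χ< A Q - χ< B Q) * ((χ< Z Y - χ< Z X) - β)
      + (χ< Q A - χ< Q B) * ((χ< Y Z - χ< X Z) + β)
      ≡⟨ cong₂ _+_ (cong₂ _+_ (cong (_* β) (χ<-crossing A B Q Q≢A Q≢B))
                              (cong (λ w → (χ< A Q - χ< B Q) * (w - β))
                                    (χ<-enterBetween X Y Z X<Y Z≢X Z≢Y)))
                   (cong (λ w → (χ< Q A - χ< Q B) * (w + β)) (χ<-leaveBetween X Y Z X<Y Z≢X Z≢Y)) ⟩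
    + 2 * γ * β + (χ< A Q - χ< B Q) * (β - β) + (χ< Q A - χ< Q B) * (- β + β)
      ≡⟨ collapse (χ< A Q - χ< B Q) (χ< Q A - χ< Q B) γ β ⟩
    + 2 * β * γ ∎
    where
    open ≡-Reasoning
    β γ : ℤ
    β = χ< X Z * χ< Z Y
    γ = χ< A Q * χ< Q B - χ< B Q * χ< Q A
    regroup : ∀ aq bq qa qb zy zx yz xz →
      aq * (zy - zx) + bq * (zx - zy) + qa * (yz - xz) + qb * (xz - yz)
      ≡ (aq - qa - bq + qb) * (xz * zy) + (aq - bq) * ((zy - zx) - xz * zy)
        + (qa - qb) * ((yz - xz) + xz * zy)
    regroup = solve-∀
    collapse : ∀ s t c b → + 2 * c * b + s * (b - b) + t * (- b + b) ≡ + 2 * b * c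
    collapse = solve-∀

  inversions : (Elem n → Elem n) → ℤ
  inversions h = ΣE λ p → ΣE λ q → χ<ᴱ p q * χ<ᴱ (h q) (h p)

  negatives : (Elem n → Elem n) → ℤ
  negatives h = ΣE λ p → χpos p * χneg (h p)

  inversions-cong : {h h′ : Elem n → Elem n} → (∀ z → h z ≡ h′ z) → inversions h ≡ inversions h′
  inversions-cong e = ΣE-cong (λ p → ΣE-cong (λ q → cong₂ (λ a b → χ<ᴱ p q * χ<ᴱ a b) (e q) (e p)))

  negatives-cong : {h h′ : Elem n → Elem n} → (∀ z → h z ≡ h′ z) → negatives h ≡ negatives h′
  negatives-cong e = ΣE-cong (λ p → cong (λ w → χpos p * χneg w) (e p))

  module SwapValues {n : ℕ} (f g : Elem n → Elem n)
    (g∘f : ∀ p → g (f p) ≡ p) (f∘g : ∀ v → f (g v) ≡ v)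
    (x y : Elem n) (x<y : toℤ x < toℤ y) where

    A B : Elem n
    A = g x
    B = g y

    A≢B : A ≢ B
    A≢B e = ℤP.<-irrefl (cong toℤ (trans (sym (f∘g x)) (trans (cong f e) (f∘g y)))) x<y

    open PairSupport A B A≢B

    swapped : Elem n → Elem n
    swapped p = transp x y (f p)

    T : Elem n → Elem n → ℤ
    T p q = χ<ᴱ p q * (χ<ᴱ (swapped q) (swapped p) - χ<ᴱ (f q) (f p))

    f≢x : ∀ p → p ≢ A → f p ≢ x
    f≢x p p≢A e = p≢A (trans (sym (g∘f p)) (cong g e))

    f≢y : ∀ p → p ≢ B → f p ≢ y
    f≢y p p≢B e = p≢B (trans (sym (g∘f p)) (cong g e))

    swapped-fix : ∀ p → p ≢ A → p ≢ B → swapped p ≡ f p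
    swapped-fix p p≢A p≢B = transp-fix x y (f p) (f≢x p p≢A) (f≢y p p≢B)

    swapped-A : swapped A ≡ y
    swapped-A = trans (cong (transp x y) (f∘g x)) (transp-at₁ x y)

    swapped-B : swapped B ≡ x
    swapped-B = trans (cong (transp x y) (f∘g y)) (transp-at₂ x y)

    T-off : ∀ p q → p ≢ A → p ≢ B → q ≢ A → q ≢ B → T p q ≡ + 0
    T-off p q p≢A p≢B q≢A q≢B rewrite swapped-fix p p≢A p≢B | swapped-fix q q≢A q≢B =
      cancel (χ<ᴱ p q) (χ<ᴱ (f q) (f p))
      where
      cancel : ∀ a b → a * (b - b) ≡ + 0
      cancel = solve-∀

    T-diag : ∀ p → T p p ≡ + 0
    T-diag p rewrite χ<ᴱ-irrefl p = refl

    K : ℤ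
    K = T A B + T B A

    K≡ : K ≡ χ<ᴱ A B - χ<ᴱ B A
    K≡ rewrite swapped-A | swapped-B | f∘g x | f∘g y | χ<-yes x<y | χ<-no (ℤP.<-asym x<y) =
      simplify (χ<ᴱ A B) (χ<ᴱ B A)
      where
      simplify : ∀ a b → a * (+ 1 - + 0) + b * (+ 0 - + 1) ≡ a - b
      simplify = solve-∀

    between : Elem n → ℤ
    between q = χ<ᴱ x (f q) * χ<ᴱ (f q) y

    crossing : Elem n → ℤ
    crossing q = between q * (χ<ᴱ A q * χ<ᴱ q B - χ<ᴱ B q * χ<ᴱ q A)

    lineSum : Elem n → ℤ
    lineSum q = T A q + T B q + (T q A + T q B)

    lineSum-outside : ∀ q → q ≢ A → q ≢ B → lineSum q ≡ + 2 * crossing q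
    lineSum-outside q q≢A q≢B
      rewrite swapped-A | swapped-B | swapped-fix q q≢A q≢B | f∘g x | f∘g y =
      trans (+-assoc-4 (χ<ᴱ A q * (χ<ᴱ (f q) y - χ<ᴱ (f q) x))
                       (χ<ᴱ B q * (χ<ᴱ (f q) x - χ<ᴱ (f q) y))
                       (χ<ᴱ q A * (χ<ᴱ y (f q) - χ<ᴱ x (f q)))
                       (χ<ᴱ q B * (χ<ᴱ x (f q) - χ<ᴱ y (f q))))
        (trans (χ<-exchange (toℤ x) (toℤ y) (toℤ (f q)) (toℤ A) (toℤ B) (toℤ q) x<y
                  (f≢x q q≢A ∘′ toℤ-injective) (f≢y q q≢B ∘′ toℤ-injective)
                  (q≢A ∘′ toℤ-injective) (q≢B ∘′ toℤ-injective))
               (ℤP.*-assoc (+ 2) (between q) (χ<ᴱ A q * χ<ᴱ q B - χ<ᴱ B q * χ<ᴱ q A)))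
      where
      +-assoc-4 : ∀ a b c d → a + b + (c + d) ≡ a + b + c + d
      +-assoc-4 = solve-∀

    lineSum-A : lineSum A ≡ K
    lineSum-A = trans (cong₂ (λ a b → a + T B A + (b + T A B)) (T-diag A) (T-diag A)) (swap (T B A) (T A B))
      where
      swap : ∀ a b → + 0 + a + (+ 0 + b) ≡ b + a
      swap = solve-∀

    lineSum-B : lineSum B ≡ K
    lineSum-B = trans (cong₂ (λ a b → T A B + a + (T B A + b)) (T-diag B) (T-diag B))
                      (cong₂ _+_ (ℤP.+-identityʳ (T A B)) (ℤP.+-identityʳ (T B A)))

    crossing-A : crossing A ≡ + 0
    crossing-A rewrite f∘g x | χ<ᴱ-irrefl x = refl

    crossing-B : crossing B ≡ + 0
    crossing-B rewrite f∘g y | χ<ᴱ-irrefl y | ℤP.*-zeroʳ (χ<ᴱ x y) = refl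

    lineSum≡ : ∀ q → lineSum q ≡ + 2 * crossing q + χ∈ q * K
    lineSum≡ q = byCases q (q ≟E A) (q ≟E B)
      where
      only-K : ∀ k → + 2 * + 0 + + 1 * k ≡ k
      only-K = solve-∀
      byCases : ∀ q → Dec (q ≡ A) → Dec (q ≡ B) → lineSum q ≡ + 2 * crossing q + χ∈ q * K
      byCases .A (yes refl) _ = trans lineSum-A (sym (trans
        (cong₂ (λ c m → + 2 * c + m * K) crossing-A (cong₂ _+_ (𝟙≡-refl A) (𝟙≡-≢ B A A≢B)))
        (only-K K)))
      byCases .B (no q≢A) (yes refl) = trans lineSum-B (sym (trans
        (cong₂ (λ c m → + 2 * c + m * K) crossing-B (cong₂ _+_ (𝟙≡-≢ A B q≢A) (𝟙≡-refl B)))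
        (only-K K)))
      byCases q (no q≢A) (no q≢B) = trans (lineSum-outside q q≢A q≢B) (sym (trans
        (cong (λ m → + 2 * crossing q + m * K) (cong₂ _+_ (𝟙≡-≢ A q q≢A) (𝟙≡-≢ B q q≢B)))
        (ℤP.+-identityʳ _)))

    inversions-swap : inversions swapped ≡ inversions f + (χ<ᴱ A B - χ<ᴱ B A) + + 2 * ΣE crossing
    inversions-swap = begin
      inversions swapped
        ≡⟨ ΣE-cong (λ p → ΣE-cong (λ q →
             split (χ<ᴱ p q) (χ<ᴱ (swapped q) (swapped p)) (χ<ᴱ (f q) (f p)))) ⟩
      ΣE (λ p → ΣE (λ q → χ<ᴱ p q * χ<ᴱ (f q) (f p) + T p q))
        ≡⟨ ΣE-cong (λ p → ΣE-+ (λ q → χ<ᴱ p q * χ<ᴱ (f q) (f p)) (T p)) ⟩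
      ΣE (λ p → ΣE (λ q → χ<ᴱ p q * χ<ᴱ (f q) (f p)) + ΣE (T p))
        ≡⟨ ΣE-+ (λ p → ΣE (λ q → χ<ᴱ p q * χ<ᴱ (f q) (f p))) (λ p → ΣE (T p)) ⟩
      inversions f + ΣE (λ p → ΣE (T p))
        ≡⟨ cong (λ w → inversions f + w) (ΣE²-supported T T-off) ⟩
      inversions f + (ΣE lineSum - (T A A + T A B + (T B A + T B B)))
        ≡⟨ cong₂ (λ s c → inversions f + (s - c))
                 (trans (ΣE-cong lineSum≡) (ΣE-+ (λ q → + 2 * crossing q) (λ q → χ∈ q * K)))
                 (cong₂ (λ a b → a + T A B + (T B A + b)) (T-diag A) (T-diag B)) ⟩
      inversions f + (ΣE (λ q → + 2 * crossing q) + ΣE (λ q → χ∈ q * K) - (+ 0 + T A B + (T B A + + 0)))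
        ≡⟨ cong₂ (λ a b → inversions f + (a + b - (+ 0 + T A B + (T B A + + 0))))
                 (ΣE-* (+ 2) crossing) (ΣE-χ∈ (λ _ → K)) ⟩
      inversions f + (+ 2 * ΣE crossing + (K + K) - (+ 0 + T A B + (T B A + + 0)))
        ≡⟨ collect (inversions f) (ΣE crossing) (T A B) (T B A) ⟩
      inversions f + K + + 2 * ΣE crossing
        ≡⟨ cong (λ k → inversions f + k + + 2 * ΣE crossing) K≡ ⟩
      inversions f + (χ<ᴱ A B - χ<ᴱ B A) + + 2 * ΣE crossing ∎
      where
      open ≡-Reasoning
      split : ∀ a b c → a * b ≡ a * c + a * (b - c)
      split = solve-∀
      collect : ∀ i s k l → i + (+ 2 * s + ((k + l) + (k + l)) - (+ 0 + k + (l + + 0))) ≡ i + (k + l) + + 2 * s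
      collect = solve-∀

    crossing-nonNeg : toℤ A < toℤ B → ∀ q → + 0 ≤ crossing q
    crossing-nonNeg A<B q rewrite χ<ᴱ-emptyInterval A B q A<B | ℤP.+-identityʳ (χ<ᴱ A q * χ<ᴱ q B) =
      bit-nonNeg (bit-* (bit-* (χ<ᴱ-bit x (f q)) (χ<ᴱ-bit (f q) y)) (bit-* (χ<ᴱ-bit A q) (χ<ᴱ-bit q B)))

    crossing-adjacent : (∀ u → toℤ x < toℤ u → toℤ u < toℤ y → ⊥) → ∀ q → crossing q ≡ + 0
    crossing-adjacent nothingBetween q
      rewrite χ<-noneBetween (toℤ x) (toℤ (f q)) (toℤ y) (nothingBetween (f q)) = refl

    crossing-down : toℤ B < toℤ A → ∀ q → crossing q ≡ - (between q * (χ<ᴱ B q * χ<ᴱ q A))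
    crossing-down B<A q rewrite χ<ᴱ-emptyInterval B A q B<A = negate (between q) (χ<ᴱ B q * χ<ᴱ q A)
      where
      negate : ∀ a b → a * (+ 0 - b) ≡ - (a * b)
      negate = solve-∀

  negatives-swap : (f g : Elem n → Elem n) → (∀ p → g (f p) ≡ p) → (∀ v → f (g v) ≡ v) →
    (x y : Elem n) → x ≢ y →
    negatives (λ p → transp x y (f p)) ≡ negatives f + (χpos (g x) - χpos (g y)) * (χneg y - χneg x)
  negatives-swap {n} f g g∘f f∘g x y x≢y = begin
    negatives (λ p → transp x y (f p))
      ≡⟨ ΣE-cong (λ p → split (χpos p) (χneg (transp x y (f p))) (χneg (f p))) ⟩
    ΣE (λ p → χpos p * χneg (f p) + change p)
      ≡⟨ ΣE-+ (λ p → χpos p * χneg (f p)) change ⟩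
    negatives f + ΣE change
      ≡⟨ cong (λ w → negatives f + w) (ΣE-supported change change-off) ⟩
    negatives f + (change A + change B)
      ≡⟨ cong₂ (λ a b → negatives f + (χpos A * (χneg (transp x y a) - χneg a)
                                       + χpos B * (χneg (transp x y b) - χneg b)))
               (f∘g x) (f∘g y) ⟩
    negatives f + (χpos A * (χneg (transp x y x) - χneg x) + χpos B * (χneg (transp x y y) - χneg y))
      ≡⟨ cong₂ (λ a b → negatives f + (χpos A * (χneg a - χneg x) + χpos B * (χneg b - χneg y)))
               (transp-at₁ x y) (transp-at₂ x y) ⟩
    negatives f + (χpos A * (χneg y - χneg x) + χpos B * (χneg x - χneg y))
      ≡⟨ factor (negatives f) (χpos A) (χpos B) (χneg x) (χneg y) ⟩
    negatives f + (χpos A - χpos B) * (χneg y - χneg x) ∎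
    where
    open ≡-Reasoning
    A B : Elem n
    A = g x
    B = g y
    open PairSupport A B (λ e → x≢y (trans (sym (f∘g x)) (trans (cong f e) (f∘g y))))
    change : Elem n → ℤ
    change p = χpos p * (χneg (transp x y (f p)) - χneg (f p))
    change-off : ∀ u → u ≢ A → u ≢ B → change u ≡ + 0
    change-off u u≢A u≢B
      rewrite transp-fix x y (f u) (λ e → u≢A (trans (sym (g∘f u)) (cong g e)))
                                    (λ e → u≢B (trans (sym (g∘f u)) (cong g e))) =
      cancel (χpos u) (χneg (f u))
      where
      cancel : ∀ a b → a * (b - b) ≡ + 0
      cancel = solve-∀
    split : ∀ a b c → a * b ≡ a * c + a * (b - c)
    split = solve-∀
    factor : ∀ s a b c d → s + (a * (d - c) + b * (c - d)) ≡ s + (a - b) * (d - c)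
    factor = solve-∀

  dlen : (Elem n → Elem n) → ℤ
  dlen h = inversions h + negatives h

  dlen-cong : {h h′ : Elem n → Elem n} → (∀ z → h z ≡ h′ z) → dlen h ≡ dlen h′
  dlen-cong e = cong₂ _+_ (inversions-cong e) (negatives-cong e)

  dlen-nonNeg : (h : Elem n → Elem n) → + 0 ≤ dlen h
  dlen-nonNeg h = ℤP.+-mono-≤ {+ 0} {_} {+ 0}
    (ΣE-nonNeg (λ p → ΣE-nonNeg (λ q → bit-nonNeg (bit-* (χ<ᴱ-bit p q) (χ<ᴱ-bit (h q) (h p))))))
    (ΣE-nonNeg (λ p → bit-nonNeg (bit-* (χpos-bit p) (χneg-bit (h p)))))

  dlen-id : dlen {n} (λ z → z) ≡ + 0
  dlen-id {n} = cong₂ _+_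
    (ΣE-zero {n} (λ p → ΣE-zero {n} (λ q → χ<-noneBetween (toℤ p) (toℤ q) (toℤ p) ℤP.<-asym)))
    (ΣE-zero {n} (λ p → χ<-noneBetween (+ 0) (toℤ p) (+ 0) ℤP.<-asym))

  module SignSwap {n : ℕ} (π : SignedPerm n) (x : Elem n) (x<0 : toℤ x < + 0) where
    private
      f g : Elem n → Elem n
      f = fun π
      g = inv π

      x<-x : toℤ x < toℤ (minus x)
      x<-x rewrite toℤ-minus x = ℤP.<-trans x<0 (ℤP.neg-mono-< x<0)

    open SwapValues f g (inv-l π) (inv-r π) x (minus x) x<-x public
      using (A; B; crossing; crossing-nonNeg; crossing-adjacent)
    open SwapValues f g (inv-l π) (inv-r π) x (minus x) x<-x
      using (inversions-swap; between; crossing-down)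

    B≡-A : B ≡ minus A
    B≡-A = inv-odd π x

    dlen-signSwap : dlen (λ z → transp x (minus x) (f z)) ≡
                    dlen f + + 2 * (χneg A - χpos A) + + 2 * ΣE crossing
    dlen-signSwap =
      trans (cong₂ _+_ inversions-swap (negatives-swap f g (inv-l π) (inv-r π) x (minus x) (u≢minus-u x)))
            rearrange
      where
      χ<ᴱ-A-B : χ<ᴱ A B ≡ χneg A
      χ<ᴱ-A-B = trans (cong₂ χ<ᴱ (sym (minus-involutive A)) B≡-A)
                      (trans (χ<ᴱ-minus-self (minus A)) (χpos-minus A))
      χ<ᴱ-B-A : χ<ᴱ B A ≡ χpos A
      χ<ᴱ-B-A = trans (cong (λ w → χ<ᴱ w A) B≡-A) (χ<ᴱ-minus-self A)
      χpos-B : χpos B ≡ χneg A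
      χpos-B = trans (cong χpos B≡-A) (χpos-minus A)
      χneg-x : χneg x ≡ + 1
      χneg-x = χ<-yes x<0
      χneg-minus-x : χneg (minus x) ≡ + 0
      χneg-minus-x rewrite toℤ-minus x = χ<-no (ℤP.<-asym (ℤP.neg-mono-< x<0))
      rearrange :
        inversions f + (χ<ᴱ A B - χ<ᴱ B A) + + 2 * ΣE crossing
          + (negatives f + (χpos A - χpos B) * (χneg (minus x) - χneg x))
        ≡ dlen f + + 2 * (χneg A - χpos A) + + 2 * ΣE crossing
      rearrange rewrite χ<ᴱ-A-B | χ<ᴱ-B-A | χpos-B | χneg-x | χneg-minus-x =
        ring (inversions f) (negatives f) (χneg A) (χpos A) (ΣE crossing)
        where
        ring : ∀ i ν a p c →
          i + (a - p) + + 2 * c + (ν + (p - a) * (+ 0 - + 1)) ≡ i + ν + + 2 * (a - p) + + 2 * c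
        ring = solve-∀

    crossings≤-2 : (z : Elem n) → + 0 < toℤ A → toℤ x < toℤ z → toℤ z < toℤ (minus x) →
      toℤ (minus A) < toℤ (g z) → toℤ (g z) < toℤ A → ΣE crossing ≤ - + 2
    crossings≤-2 z 0<A x<z z<-x -A<Z Z<A = begin
      ΣE crossing   ≡⟨ ΣE-cong (λ q → trans (crossing-down B<A q) (sym (ℤP.-1*i≡-i (straddle q)))) ⟩
      ΣE (λ q → - + 1 * straddle q)  ≡⟨ trans (ΣE-* (- + 1) straddle) (ℤP.-1*i≡-i (ΣE straddle)) ⟩
      - ΣE straddle  ≤⟨ ℤP.neg-mono-≤ ΣE-straddle≥2 ⟩
      - + 2          ∎
      where
      open ℤP.≤-Reasoning
      B<A : toℤ B < toℤ A
      B<A = subst (_< toℤ A) (sym (trans (cong toℤ B≡-A) (toℤ-minus A)))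
                  (ℤP.<-trans (ℤP.neg-mono-< 0<A) 0<A)
      straddle : Elem n → ℤ
      straddle q = between q * (χ<ᴱ B q * χ<ᴱ q A)
      straddle-nonNeg : ∀ q → + 0 ≤ straddle q
      straddle-nonNeg q = bit-nonNeg (bit-* (bit-* (χ<ᴱ-bit x (f q)) (χ<ᴱ-bit (f q) (minus x)))
                                            (bit-* (χ<ᴱ-bit B q) (χ<ᴱ-bit q A)))
      straddle-z : straddle (g z) ≡ + 1
      straddle-z rewrite inv-r π z | χ<-yes x<z | χ<-yes z<-x | B≡-A | χ<-yes -A<Z | χ<-yes Z<A = refl
      straddle-minus-z : straddle (minus (g z)) ≡ + 1
      straddle-minus-z = cong₂ _*_ (cong₂ _*_ x<-z -z<-x) (cong₂ _*_ -A<-Z -Z<A)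
        where
        f-z : f (minus (g z)) ≡ minus z
        f-z = trans (odd π (g z)) (cong minus (inv-r π z))
        x<-z : χ<ᴱ x (f (minus (g z))) ≡ + 1
        x<-z = trans (cong₂ χ<ᴱ (sym (minus-involutive x)) f-z) (trans (χ<ᴱ-minus (minus x) z) (χ<-yes z<-x))
        -z<-x : χ<ᴱ (f (minus (g z))) (minus x) ≡ + 1
        -z<-x = trans (cong (λ w → χ<ᴱ w (minus x)) f-z) (trans (χ<ᴱ-minus z x) (χ<-yes x<z))
        -A<-Z : χ<ᴱ B (minus (g z)) ≡ + 1
        -A<-Z = trans (cong (λ w → χ<ᴱ w (minus (g z))) B≡-A) (trans (χ<ᴱ-minus A (g z)) (χ<-yes Z<A))
        -Z<A : χ<ᴱ (minus (g z)) A ≡ + 1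
        -Z<A = trans (cong (χ<ᴱ (minus (g z))) (sym (minus-involutive A)))
                     (trans (χ<ᴱ-minus (g z) (minus A)) (χ<-yes -A<Z))
      ΣE-straddle≥2 : + 2 ≤ ΣE straddle
      ΣE-straddle≥2 = ℤP.≤-trans (ℤP.≤-reflexive (sym (cong₂ _+_ straddle-z straddle-minus-z)))
        (PairSupport.ΣE-≥-pair (g z) (minus (g z)) (u≢minus-u (g z)) straddle straddle-nonNeg)

  module PairSwap {n : ℕ} (π : SignedPerm n) (x y : Elem n)
    (x<y : toℤ x < toℤ y) (x≢-y : x ≢ minus y) where
    private
      f g t₋ f₂ g₂ : Elem n → Elem n
      f = fun π
      g = inv π
      t₋ = transp (minus x) (minus y)
      f₂ p = t₋ (f p)
      g₂ v = g (t₋ v)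

      x≢y : x ≢ y
      x≢y e = ℤP.<-irrefl (cong toℤ e) x<y

      -y<-x : toℤ (minus y) < toℤ (minus x)
      -y<-x rewrite toℤ-minus x | toℤ-minus y = ℤP.neg-mono-< x<y

      t₋-x : t₋ x ≡ x
      t₋-x = transp-fix (minus x) (minus y) x (u≢minus-u x) x≢-y

      t₋-y : t₋ y ≡ y
      t₋-y = transp-fix (minus x) (minus y) y
               (λ e → x≢-y (trans (sym (minus-involutive x)) (cong minus (sym e)))) (u≢minus-u y)

      g₂∘f₂ : ∀ p → g₂ (f₂ p) ≡ p
      g₂∘f₂ p = trans (cong g (transp-involutive (minus x) (minus y) (f p))) (inv-l π p)

      f₂∘g₂ : ∀ v → f₂ (g₂ v) ≡ v
      f₂∘g₂ v = trans (cong t₋ (inv-r π (t₋ v))) (transp-involutive (minus x) (minus y) v)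

      module Inner = SwapValues f g (inv-l π) (inv-r π) (minus y) (minus x) -y<-x
      module Outer = SwapValues f₂ g₂ g₂∘f₂ f₂∘g₂ x y x<y

    d ε crossings : ℤ
    d = χ<ᴱ (g x) (g y) - χ<ᴱ (g y) (g x)
    ε = (χpos (g x) - χpos (g y)) * (χpos x - χpos y)
    crossings = ΣE Inner.crossing + ΣE Outer.crossing

    inversions-pairSwap : inversions (λ z → transp x y (f₂ z)) ≡ inversions f + + 2 * d + + 2 * crossings
    inversions-pairSwap = begin
      inversions (λ z → transp x y (f₂ z))
        ≡⟨ Outer.inversions-swap ⟩
      inversions f₂ + d₁ + + 2 * ΣE Outer.crossing
        ≡⟨ cong (λ i → i + d₁ + + 2 * ΣE Outer.crossing)
                (trans (inversions-cong (λ z → transp-sym (minus x) (minus y) (f z))) Inner.inversions-swap) ⟩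
      inversions f + d₂ + + 2 * ΣE Inner.crossing + d₁ + + 2 * ΣE Outer.crossing
        ≡⟨ cong₂ (λ a b → inversions f + a + + 2 * ΣE Inner.crossing + b + + 2 * ΣE Outer.crossing)
                 d₂≡d d₁≡d ⟩
      inversions f + d + + 2 * ΣE Inner.crossing + d + + 2 * ΣE Outer.crossing
        ≡⟨ ring (inversions f) d (ΣE Inner.crossing) (ΣE Outer.crossing) ⟩
      inversions f + + 2 * d + + 2 * crossings ∎
      where
      open ≡-Reasoning
      d₁ d₂ : ℤ
      d₁ = χ<ᴱ (g₂ x) (g₂ y) - χ<ᴱ (g₂ y) (g₂ x)
      d₂ = χ<ᴱ (g (minus y)) (g (minus x)) - χ<ᴱ (g (minus x)) (g (minus y))
      d₁≡d : d₁ ≡ d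
      d₁≡d rewrite t₋-x | t₋-y = refl
      d₂≡d : d₂ ≡ d
      d₂≡d rewrite inv-odd π x | inv-odd π y = cong₂ _-_ (χ<ᴱ-minus (g y) (g x)) (χ<ᴱ-minus (g x) (g y))
      ring : ∀ i d c₂ c₁ → i + d + + 2 * c₂ + d + + 2 * c₁ ≡ i + + 2 * d + + 2 * (c₂ + c₁)
      ring = solve-∀

    negatives-pairSwap : negatives (λ z → transp x y (f₂ z)) ≡ negatives f + + 2 * ε
    negatives-pairSwap = begin
      negatives (λ z → transp x y (f₂ z))
        ≡⟨ negatives-swap f₂ g₂ g₂∘f₂ f₂∘g₂ x y x≢y ⟩
      negatives f₂ + ε₁
        ≡⟨ cong (_+ ε₁) (negatives-swap f g (inv-l π) (inv-r π) (minus x) (minus y)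
                                        (x≢y ∘′ minus-injective)) ⟩
      negatives f + ε₂ + ε₁
        ≡⟨ cong₂ (λ a b → negatives f + a + b) ε₂≡ε ε₁≡ε ⟩
      negatives f + ε + ε
        ≡⟨ ring (negatives f) ε ⟩
      negatives f + + 2 * ε ∎
      where
      open ≡-Reasoning
      ε₁ ε₂ : ℤ
      ε₁ = (χpos (g₂ x) - χpos (g₂ y)) * (χneg y - χneg x)
      ε₂ = (χpos (g (minus x)) - χpos (g (minus y))) * (χneg (minus y) - χneg (minus x))
      ε₁≡ε : ε₁ ≡ ε
      ε₁≡ε rewrite t₋-x | t₋-y | χneg≡1-χpos x | χneg≡1-χpos y =
        flip (χpos (g x) - χpos (g y)) (χpos x) (χpos y)
        where
        flip : ∀ a p q → a * (+ 1 - q - (+ 1 - p)) ≡ a * (p - q)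
        flip = solve-∀
      ε₂≡ε : ε₂ ≡ ε
      ε₂≡ε rewrite inv-odd π x | inv-odd π y | χpos-minus (g x) | χpos-minus (g y)
                 | χneg-minus x | χneg-minus y | χneg≡1-χpos (g x) | χneg≡1-χpos (g y) =
        flip (χpos (g x)) (χpos (g y)) (χpos x) (χpos y)
        where
        flip : ∀ a b p q → (+ 1 - a - (+ 1 - b)) * (q - p) ≡ (a - b) * (p - q)
        flip = solve-∀
      ring : ∀ ν e → ν + e + e ≡ ν + + 2 * e
      ring = solve-∀

    dlen-pairSwap : dlen (λ z → transp x y (t₋ (f z))) ≡ dlen f + + 2 * d + + 2 * crossings + + 2 * ε
    dlen-pairSwap = trans (cong₂ _+_ inversions-pairSwap negatives-pairSwap)
                          (ring (inversions f) (negatives f) d crossings ε)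
      where
      ring : ∀ i ν d c e → i + + 2 * d + + 2 * c + (ν + + 2 * e) ≡ i + ν + + 2 * d + + 2 * c + + 2 * e
      ring = solve-∀

    crossings-nonNeg : toℤ (g x) < toℤ (g y) → + 0 ≤ crossings
    crossings-nonNeg gx<gy = ℤP.+-mono-≤ {+ 0} {_} {+ 0}
      (ΣE-nonNeg (Inner.crossing-nonNeg inner-order))
      (ΣE-nonNeg (Outer.crossing-nonNeg
        (subst₂ (λ a b → toℤ (g a) < toℤ (g b)) (sym t₋-x) (sym t₋-y) gx<gy)))
      where
      inner-order : toℤ (g (minus y)) < toℤ (g (minus x))
      inner-order rewrite inv-odd π x | inv-odd π y | toℤ-minus (g x) | toℤ-minus (g y) = ℤP.neg-mono-< gx<gy

    crossings-adjacent : (∀ u → toℤ x < toℤ u → toℤ u < toℤ y → ⊥) → crossings ≡ + 0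
    crossings-adjacent nothingBetween = cong₂ _+_
      (ΣE-zero (Inner.crossing-adjacent nothingBetween-minus))
      (ΣE-zero (Outer.crossing-adjacent nothingBetween))
      where
      nothingBetween-minus : ∀ u → toℤ (minus y) < toℤ u → toℤ u < toℤ (minus x) → ⊥
      nothingBetween-minus u -y<u u<-x = nothingBetween (minus u)
        (subst₂ _<_ (ℤP.neg-involutive (toℤ x)) (sym (toℤ-minus u))
          (ℤP.neg-mono-< (subst (toℤ u <_) (toℤ-minus x) u<-x)))
        (subst₂ _<_ (sym (toℤ-minus u)) (ℤP.neg-involutive (toℤ y))
          (ℤP.neg-mono-< (subst (_< toℤ u) (toℤ-minus y) -y<u)))

    dlen-pairSwap-≥ : toℤ (g x) < toℤ (g y) → dlen f ≤ dlen (λ z → transp x y (t₋ (f z)))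
    dlen-pairSwap-≥ gx<gy = begin
      dlen f
        ≡⟨ ring (dlen f) ⟩
      dlen f + + 2 * + 1 + + 2 * + 0 + + 2 * - + 1
        ≤⟨ ℤP.+-mono-≤ (ℤP.+-monoʳ-≤ (dlen f + + 2 * + 1) (ℤP.*-monoˡ-≤-nonNeg (+ 2) (crossings-nonNeg gx<gy)))
                       (ℤP.*-monoˡ-≤-nonNeg (+ 2) ε≥-1) ⟩
      dlen f + + 2 * + 1 + + 2 * crossings + + 2 * ε
        ≡⟨ cong (λ w → dlen f + + 2 * w + + 2 * crossings + + 2 * ε) (sym d≡1) ⟩
      dlen f + + 2 * d + + 2 * crossings + + 2 * ε
        ≡⟨ sym dlen-pairSwap ⟩
      dlen (λ z → transp x y (t₋ (f z))) ∎
      where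
      open ℤP.≤-Reasoning
      d≡1 : d ≡ + 1
      d≡1 = cong₂ _-_ (χ<-yes gx<gy) (χ<-no (ℤP.<-asym gx<gy))
      ε≥-1 : - + 1 ≤ ε
      ε≥-1 = bit-diffProduct≥-1 (χpos-bit (g x)) (χpos-bit (g y)) (χpos-bit x) (χpos-bit y)
      ring : ∀ a → a ≡ a + + 2 * + 1 + + 2 * + 0 + + 2 * - + 1
      ring = solve-∀

  nothingBetween-±1 : {m : ℕ} (u : Elem (suc m)) →
    toℤ (neg {suc m} zero) < toℤ u → toℤ u < toℤ (pos {suc m} zero) → ⊥
  nothingBetween-±1 (pos i) _ (+<+ (s≤s ()))
  nothingBetween-±1 (neg i) (-<- ()) _

  nothingBetween-consecutive : {m : ℕ} (j : Fin m) (u : Elem (suc m)) →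
    toℤ (pos (inject₁ j)) < toℤ u → toℤ u < toℤ (pos (suc j)) → ⊥
  nothingBetween-consecutive j (pos i) (+<+ j<i) (+<+ i<j+1) rewrite FinP.toℕ-inject₁ j =
    ℕP.<-irrefl refl (ℕP.<-≤-trans (ℕ.s<s⁻¹ j<i) (ℕ.s≤s⁻¹ (ℕ.s<s⁻¹ i<j+1)))
  nothingBetween-consecutive j (neg i) () _

  dlen-gen₀ : {m : ℕ} (π : SignedPerm (suc m)) →
    dlen (λ z → gen zero (fun π z)) ≡
    dlen (fun π) + + 2 * (χpos (inv π (pos zero)) - χneg (inv π (pos zero)))
  dlen-gen₀ {m} π = begin
    dlen (λ z → gen zero (fun π z))
      ≡⟨ dlen-cong (λ z → transp-sym (pos zero) (neg zero) (fun π z)) ⟩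
    dlen (λ z → transp (neg zero) (pos zero) (fun π z))
      ≡⟨ S.dlen-signSwap ⟩
    dlen (fun π) + + 2 * (χneg S.A - χpos S.A) + + 2 * ΣE S.crossing
      ≡⟨ cong₂ (λ a c → dlen (fun π) + + 2 * a + + 2 * c)
               signs (ΣE-zero (S.crossing-adjacent nothingBetween-±1)) ⟩
    dlen (fun π) + + 2 * (χpos B - χneg B) + + 2 * + 0
      ≡⟨ ℤP.+-identityʳ _ ⟩
    dlen (fun π) + + 2 * (χpos B - χneg B) ∎
    where
    open ≡-Reasoning
    module S = SignSwap π (neg zero) -<+
    B : Elem (suc m)
    B = inv π (pos zero)
    signs : χneg S.A - χpos S.A ≡ χpos B - χneg B
    signs rewrite inv-odd π (pos zero) = cong₂ _-_ (χneg-minus B) (χpos-minus B)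

  dlen-gen-suc : {m : ℕ} (π : SignedPerm (suc m)) (j : Fin m) →
    dlen (λ z → gen (suc j) (fun π z)) ≡
    dlen (fun π) + + 2 * (χ<ᴱ (inv π (pos (inject₁ j))) (inv π (pos (suc j)))
                          - χ<ᴱ (inv π (pos (suc j))) (inv π (pos (inject₁ j))))
  dlen-gen-suc π j = begin
    dlen (λ z → gen (suc j) (fun π z))
      ≡⟨ P.dlen-pairSwap ⟩
    dlen (fun π) + + 2 * P.d + + 2 * P.crossings + + 2 * P.ε
      ≡⟨ cong₂ (λ c e → dlen (fun π) + + 2 * P.d + + 2 * c + + 2 * e)
               (P.crossings-adjacent (nothingBetween-consecutive j)) ε≡0 ⟩
    dlen (fun π) + + 2 * P.d + + 2 * + 0 + + 2 * + 0
      ≡⟨ trans (ℤP.+-identityʳ _) (ℤP.+-identityʳ _) ⟩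
    dlen (fun π) + + 2 * P.d ∎
    where
    open ≡-Reasoning
    j<j+1 : toℤ (pos (inject₁ j)) < toℤ (pos (suc j))
    j<j+1 = +<+ (s≤s (s≤s (ℕP.≤-reflexive (FinP.toℕ-inject₁ j))))
    module P = PairSwap π (pos (inject₁ j)) (pos (suc j)) j<j+1 (λ ())
    ε≡0 : P.ε ≡ + 0
    ε≡0 = trans (cong₂ (λ a b → (χpos (inv π (pos (inject₁ j))) - χpos (inv π (pos (suc j)))) * (a - b))
                       (χpos-pos (inject₁ j)) (χpos-pos (suc j)))
                (ℤP.*-zeroʳ (χpos (inv π (pos (inject₁ j))) - χpos (inv π (pos (suc j)))))

  dlen-gen≤ : (π : SignedPerm n) (k : Fin n) → dlen (λ z → gen k (fun π z)) ≤ dlen (fun π) + + 2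
  dlen-gen≤ {suc m} π zero = ℤP.≤-trans (ℤP.≤-reflexive (dlen-gen₀ π))
    (ℤP.+-monoʳ-≤ (dlen (fun π))
      (ℤP.*-monoˡ-≤-nonNeg (+ 2) (bit-diff≤1 (χpos-bit (inv π (pos zero))) (χneg-bit (inv π (pos zero))))))
  dlen-gen≤ {suc m} π (suc j) = ℤP.≤-trans (ℤP.≤-reflexive (dlen-gen-suc π j))
    (ℤP.+-monoʳ-≤ (dlen (fun π))
      (ℤP.*-monoˡ-≤-nonNeg (+ 2) (bit-diff≤1 (χ<ᴱ-bit (inv π (pos (inject₁ j))) (inv π (pos (suc j))))
                                             (χ<ᴱ-bit (inv π (pos (suc j))) (inv π (pos (inject₁ j)))))))

  +-cancelʳ-≤ : ∀ a b c → a + c ≤ b + c → a ≤ b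
  +-cancelʳ-≤ a b c a+c≤b+c = subst₂ _≤_ (add-sub a c) (add-sub b c) (ℤP.+-monoˡ-≤ (- c) a+c≤b+c)
    where
    add-sub : ∀ x y → x + y + - y ≡ x
    add-sub = solve-∀

  module IncreasingChain {m : ℕ} (s : Fin (suc m) → ℤ) (0<s₀ : + 0 < s zero)
    (increasing : ∀ j → s (inject₁ j) < s (suc j)) (bounded : ∀ i → s i ≤ + suc m) where

    private
      lower : ∀ k (i : Fin (suc m)) → toℕ i ≡ k → + suc k ≤ s i
      lower zero zero _ = ℤP.i<j⇒suc[i]≤j 0<s₀
      lower (suc k) (suc j) e =
        ℤP.≤-trans (ℤP.+-monoʳ-≤ (+ 1)
                     (lower k (inject₁ j) (trans (FinP.toℕ-inject₁ j) (ℕP.suc-injective e))))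
                   (ℤP.i<j⇒suc[i]≤j (increasing j))

      upper : ∀ d (i : Fin (suc m)) → toℕ i ℕ.+ d ≡ m → s i + + d ≤ + suc m
      upper zero i e = subst (_≤ + suc m) (sym (ℤP.+-identityʳ (s i))) (bounded i)
      upper (suc d) i e = begin
        s i + + suc d          ≡⟨ shift (s i) (+ d) ⟩
        (+ 1 + s i) + + d      ≡⟨ cong (λ w → + 1 + s w + + d) (sym (FinP.inject₁-lower₁ i m≢i)) ⟩
        (+ 1 + s (inject₁ j)) + + d  ≤⟨ ℤP.+-monoˡ-≤ (+ d) (ℤP.i<j⇒suc[i]≤j (increasing j)) ⟩
        s (suc j) + + d        ≤⟨ upper d (suc j) e′ ⟩
        + suc m                ∎
        where
        open ℤP.≤-Reasoning
        m≢i : m ≢ toℕ i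
        m≢i m≡i = ℕP.m+1+n≢m (toℕ i) (trans e m≡i)
        j : Fin m
        j = lower₁ i m≢i
        e′ : toℕ (suc j) ℕ.+ d ≡ m
        e′ = trans (cong (λ w → suc w ℕ.+ d) (FinP.toℕ-lower₁ i m≢i))
                   (trans (sym (ℕP.+-suc (toℕ i) d)) e)
        shift : ∀ a b → a + (+ 1 + b) ≡ + 1 + a + b
        shift = solve-∀

    chain≡index : ∀ i → s i ≡ + suc (toℕ i)
    chain≡index i = ℤP.≤-antisym (+-cancelʳ-≤ (s i) (+ suc (toℕ i)) (+ (m ℕ.∸ toℕ i)) above)
                                 (lower (toℕ i) i refl)
      where
      i+[m-i]≡m : toℕ i ℕ.+ (m ℕ.∸ toℕ i) ≡ m
      i+[m-i]≡m = ℕP.m+[n∸m]≡n (ℕ.s≤s⁻¹ (FinP.toℕ<n i))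
      above : s i + + (m ℕ.∸ toℕ i) ≤ + suc (toℕ i) + + (m ℕ.∸ toℕ i)
      above = ℤP.≤-trans (upper (m ℕ.∸ toℕ i) i i+[m-i]≡m)
                         (ℤP.≤-reflexive (cong (λ w → + suc w) (sym i+[m-i]≡m)))

  Descent : SignedPerm n → Set
  Descent {n} π = Σ (Fin n) λ k → dlen (λ z → gen k (fun π z)) + + 2 ≡ dlen (fun π)

  descent-or-identity : (π : SignedPerm n) → Descent π ⊎ (∀ z → fun π z ≡ z)
  descent-or-identity {zero} π = inj₂ (λ { (pos ()) ; (neg ()) })
  descent-or-identity {suc m} π
    with FinP.any? (λ k → dlen (λ z → gen k (fun π z)) + + 2 ℤP.≟ dlen (fun π))
  ... | yes d = inj₁ d
  ... | no noDescent = inj₂ identity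
    where
    g : Elem (suc m) → Elem (suc m)
    g = inv π
    drop : ∀ {k} x → dlen (λ z → gen k (fun π z)) ≡ dlen (fun π) + + 2 * x → x ≡ - + 1 → ⊥
    drop {k} x eq x≡-1 = noDescent (k , trans (cong (_+ + 2) eq)
      (trans (cong (λ w → dlen (fun π) + + 2 * w + + 2) x≡-1) (cancel (dlen (fun π)))))
      where
      cancel : ∀ a → a + + 2 * - + 1 + + 2 ≡ a
      cancel = solve-∀
    g1>0 : + 0 < toℤ (g (pos zero))
    g1>0 with χpos-bit (g (pos zero))
    ... | inj₂ e = χ<≡1⇒< e
    ... | inj₁ e = ⊥-elim (drop {zero} _ (dlen-gen₀ π) (cong₂ _-_ e χneg≡1))
      where
      χneg≡1 : χneg (g (pos zero)) ≡ + 1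
      χneg≡1 = trans (χneg≡1-χpos (g (pos zero))) (cong (λ w → + 1 - w) e)
    increasing : ∀ j → toℤ (g (pos (inject₁ j))) < toℤ (g (pos (suc j)))
    increasing j with ℤP.<-cmp (toℤ (g (pos (inject₁ j)))) (toℤ (g (pos (suc j))))
    ... | tri< lt _ _ = lt
    ... | tri≈ _ eq _ = ⊥-elim (ℕP.<-irrefl (trans (sym (FinP.toℕ-inject₁ j)) (cong toℕ (pos-injective
                          (inv-injective π (toℤ-injective eq))))) (ℕP.n<1+n (toℕ j)))
      where
      pos-injective : ∀ {a b : Fin (suc m)} → pos a ≡ pos b → a ≡ b
      pos-injective refl = refl
    ... | tri> _ _ gt =
      ⊥-elim (drop {suc j} _ (dlen-gen-suc π j) (cong₂ _-_ (χ<-no (ℤP.<-asym gt)) (χ<-yes gt)))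
    open IncreasingChain (λ i → toℤ (g (pos i))) g1>0 increasing (λ i → toℤ≤n (g (pos i)))
    fixes-pos : ∀ i → fun π (pos i) ≡ pos i
    fixes-pos i = trans (cong (fun π) (sym (toℤ-injective (chain≡index i)))) (inv-r π (pos i))
    identity : ∀ z → fun π z ≡ z
    identity (pos i) = fixes-pos i
    identity (neg i) = trans (odd π (pos i)) (cong minus (fixes-pos i))

  double : ℕ → ℤ
  double k = + (k ℕ.+ k)

  double-suc : ∀ k → double (suc k) ≡ double k + + 2
  double-suc k = cong +_ (trans (cong suc (ℕP.+-suc k k)) (ℕP.+-comm 2 (k ℕ.+ k)))

  dlen-word≤ : (w : List (Fin n)) → dlen (fun (wordSP w)) ≤ double (length w)
  dlen-word≤ {n} [] = ℤP.≤-reflexive (dlen-id {n})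
  dlen-word≤ (k ∷ w) = begin
    dlen (λ z → gen k (fun (wordSP w) z))  ≤⟨ dlen-gen≤ (wordSP w) k ⟩
    dlen (fun (wordSP w)) + + 2            ≤⟨ ℤP.+-monoˡ-≤ (+ 2) (dlen-word≤ w) ⟩
    double (length w) + + 2                ≡⟨ sym (double-suc (length w)) ⟩
    double (suc (length w))                ∎
    where open ℤP.≤-Reasoning

  ReducedWord : SignedPerm n → Set
  ReducedWord {n} π = Σ (List (Fin n)) λ w → Represents w (fun π) × double (length w) ≡ dlen (fun π)

  reducedWord-bounded : (N : ℕ) (π : SignedPerm n) → dlen (fun π) ≤ + N → ReducedWord π
  reducedWord-bounded {n} N π bound with descent-or-identity π
  ... | inj₂ isId = [] , (λ z → sym (isId z)) , sym (trans (dlen-cong isId) (dlen-id {n}))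
  ... | inj₁ (k , drop) = extend N bound
    where
    π′ : SignedPerm n
    π′ = genSP k ∘SP π
    2≤dlen : + 2 ≤ dlen (fun π)
    2≤dlen = ℤP.≤-trans (ℤP.+-monoˡ-≤ (+ 2) (dlen-nonNeg (fun π′))) (ℤP.≤-reflexive drop)
    extend : ∀ N → dlen (fun π) ≤ + N → ReducedWord π
    extend 0 bound with ℤP.≤-trans 2≤dlen bound
    ... | +≤+ ()
    extend 1 bound with ℤP.≤-trans 2≤dlen bound
    ... | +≤+ (s≤s ())
    extend (suc (suc N′)) bound with reducedWord-bounded N′ π′ bound′
      where
      bound′ : dlen (fun π′) ≤ + N′
      bound′ = +-cancelʳ-≤ (dlen (fun π′)) (+ N′) (+ 2)
        (ℤP.≤-trans (ℤP.≤-reflexive drop)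
                    (ℤP.≤-trans bound (ℤP.≤-reflexive (cong +_ (ℕP.+-comm 2 N′)))))
    ... | w , represents , len =
      k ∷ w ,
      (λ z → trans (cong (gen k) (represents z)) (gen-involutive k (fun π z))) ,
      trans (double-suc (length w)) (trans (cong (_+ + 2) len) drop)

  reducedWord : (π : SignedPerm n) → ReducedWord π
  reducedWord π = reducedWord-bounded ∣ dlen (fun π) ∣ π
    (ℤP.≤-reflexive (sym (ℤP.0≤i⇒+∣i∣≡i (dlen-nonNeg (fun π)))))

  dlen-hasLength : (h : Elem n → Elem n) (k : ℕ) → HasLength h k → dlen h ≡ double k
  dlen-hasLength {n} h k ((w , |w|≡k , w-represents) , minimal) = ℤP.≤-antisym upper lower
    where
    π₀ : SignedPerm n
    π₀ = wordSP w
    π₀≗h : ∀ z → fun π₀ z ≡ h z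
    π₀≗h z = trans (sym (wordSP-represents w z)) (w-represents z)
    upper : dlen h ≤ double k
    upper = ℤP.≤-trans (ℤP.≤-reflexive (sym (dlen-cong π₀≗h)))
              (ℤP.≤-trans (dlen-word≤ w) (ℤP.≤-reflexive (cong double |w|≡k)))
    lower : double k ≤ dlen h
    lower with reducedWord π₀
    ... | w′ , w′-represents , len′ =
      ℤP.≤-trans (+≤+ (ℕP.+-mono-≤ k≤ k≤)) (ℤP.≤-reflexive (trans len′ (dlen-cong π₀≗h)))
      where
      k≤ : k ℕ.≤ length w′
      k≤ = minimal w′ (λ z → trans (w′-represents z) (π₀≗h z))

  DropsByOne : SignedPerm n → (Elem n → Elem n) → Set
  DropsByOne π u = dlen (λ z → u (fun π z)) + + 2 ≡ dlen (fun π)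

  edge-dropsByOne : (π : SignedPerm n) (x y : Elem n) → Edge π x y →
    Σ (Elem n → Elem n) λ u → U π x y u × DropsByOne π u
  edge-dropsByOne π x y (_ , u , u-def , k , ℓ[uπ]≡k , ℓ[π]≡k+1) =
    u , u-def , trans (cong (_+ + 2) (dlen-hasLength _ k ℓ[uπ]≡k))
                      (trans (sym (double-suc k)) (sym (dlen-hasLength (fun π) (suc k) ℓ[π]≡k+1)))

  ¬drop-if-≥ : (π : SignedPerm n) (u : Elem n → Elem n) →
    dlen (fun π) ≤ dlen (λ z → u (fun π z)) → ¬ DropsByOne π u
  ¬drop-if-≥ π u ≥ drop = ℤP.<-irrefl refl (begin-strict
    dlen (fun π)                        ≤⟨ ≥ ⟩
    dlen (λ z → u (fun π z))            <⟨ i<i+2 (dlen (λ z → u (fun π z))) ⟩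
    dlen (λ z → u (fun π z)) + + 2      ≡⟨ drop ⟩
    dlen (fun π)                        ∎)
    where
    open ℤP.≤-Reasoning
    i<i+2 : ∀ i → i < i + + 2
    i<i+2 i = ℤP.≤-<-trans (ℤP.≤-reflexive (sym (ℤP.+-identityʳ i)))
                           (ℤP.+-monoʳ-< i (+<+ (s≤s z≤n)))

  ¬drop-signSwap-positive : (π : SignedPerm n) (x : Elem n) → + 0 < toℤ x → + 0 < toℤ (inv π x) →
    ¬ DropsByOne π (transp x (minus x))
  ¬drop-signSwap-positive {n} π x 0<x 0<gx = ¬drop-if-≥ π (transp x (minus x)) (begin
    dlen f
      ≤⟨ ℤP.i≤i+j (dlen f) (+ 2) ⟩
    dlen f + + 2
      ≡⟨ sym (ℤP.+-identityʳ _) ⟩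
    dlen f + + 2 * (+ 1 - + 0) + + 2 * + 0
      ≤⟨ ℤP.+-monoʳ-≤ (dlen f + + 2 * (+ 1 - + 0)) (ℤP.*-monoˡ-≤-nonNeg (+ 2) C≥0) ⟩
    dlen f + + 2 * (+ 1 - + 0) + + 2 * ΣE S.crossing
      ≡⟨ cong (λ w → dlen f + + 2 * w + + 2 * ΣE S.crossing) (sym signs) ⟩
    dlen f + + 2 * (χneg S.A - χpos S.A) + + 2 * ΣE S.crossing
      ≡⟨ sym S.dlen-signSwap ⟩
    dlen (λ z → transp (minus x) (minus (minus x)) (f z))
      ≡⟨ dlen-cong swap-back ⟩
    dlen (λ z → transp x (minus x) (f z)) ∎)
    where
    open ℤP.≤-Reasoning
    f : Elem n → Elem n
    f = fun π
    -x<0 : toℤ (minus x) < + 0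
    -x<0 rewrite toℤ-minus x = ℤP.neg-mono-< 0<x
    module S = SignSwap π (minus x) -x<0
    A<0 : toℤ S.A < + 0
    A<0 rewrite inv-odd π x | toℤ-minus (inv π x) = ℤP.neg-mono-< 0<gx
    signs : χneg S.A - χpos S.A ≡ + 1 - + 0
    signs = cong₂ _-_ (χ<-yes A<0) (χ<-no (ℤP.<-asym A<0))
    C≥0 : + 0 ≤ ΣE S.crossing
    C≥0 = ΣE-nonNeg (S.crossing-nonNeg (subst (λ w → toℤ S.A < toℤ w) (sym S.B≡-A)
      (subst (toℤ S.A <_) (sym (toℤ-minus S.A)) (ℤP.<-trans A<0 (ℤP.neg-mono-< A<0)))))
    swap-back : ∀ z → transp (minus x) (minus (minus x)) (f z) ≡ transp x (minus x) (f z)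
    swap-back z rewrite minus-involutive x = transp-sym (minus x) x (f z)

  ¬drop-if-≤ : (π : SignedPerm n) (u : Elem n → Elem n) →
    dlen (λ z → u (fun π z)) + + 4 ≤ dlen (fun π) → ¬ DropsByOne π u
  ¬drop-if-≤ π u ≤ drop = ℤP.<-irrefl refl (begin-strict
    dlen (fun π)                    ≡⟨ sym drop ⟩
    dlen (λ z → u (fun π z)) + + 2  <⟨ ℤP.+-monoʳ-< (dlen (λ z → u (fun π z))) (+<+ (s≤s (s≤s (s≤s z≤n)))) ⟩
    dlen (λ z → u (fun π z)) + + 4  ≤⟨ ≤ ⟩
    dlen (fun π)                    ∎)
    where open ℤP.≤-Reasoning

  ¬drop-signSwap-straddled : (π : SignedPerm n) (x z : Elem n) → toℤ x < + 0 → + 0 < toℤ (inv π x) →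
    toℤ x < toℤ z → toℤ z < toℤ (minus x) →
    toℤ (minus (inv π x)) < toℤ (inv π z) → toℤ (inv π z) < toℤ (inv π x) →
    ¬ DropsByOne π (transp x (minus x))
  ¬drop-signSwap-straddled π x z x<0 0<A x<z z<-x -A<Z Z<A = ¬drop-if-≤ π (transp x (minus x)) (begin
    dlen (λ p → transp x (minus x) (fun π p)) + + 4
      ≡⟨ cong (_+ + 4) S.dlen-signSwap ⟩
    dlen (fun π) + + 2 * (χneg S.A - χpos S.A) + + 2 * ΣE S.crossing + + 4
      ≤⟨ ℤP.+-monoˡ-≤ (+ 4) (ℤP.+-monoʳ-≤ (dlen (fun π) + + 2 * (χneg S.A - χpos S.A))
           (ℤP.*-monoˡ-≤-nonNeg (+ 2) (S.crossings≤-2 z 0<A x<z z<-x -A<Z Z<A))) ⟩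
    dlen (fun π) + + 2 * (χneg S.A - χpos S.A) + + 2 * - + 2 + + 4
      ≡⟨ cong (λ a → dlen (fun π) + + 2 * a + + 2 * - + 2 + + 4) signs ⟩
    dlen (fun π) + + 2 * (+ 0 - + 1) + + 2 * - + 2 + + 4
      ≡⟨ ring (dlen (fun π)) ⟩
    dlen (fun π) + - + 2
      ≤⟨ ℤP.+-monoʳ-≤ (dlen (fun π)) -≤+ ⟩
    dlen (fun π) + + 0
      ≡⟨ ℤP.+-identityʳ (dlen (fun π)) ⟩
    dlen (fun π) ∎)
    where
    open ℤP.≤-Reasoning
    module S = SignSwap π x x<0
    signs : χneg S.A - χpos S.A ≡ + 0 - + 1
    signs = cong₂ _-_ (χ<-no (ℤP.<-asym 0<A)) (χ<-yes 0<A)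
    ring : ∀ a → a + + 2 * (+ 0 - + 1) + + 2 * - + 2 + + 4 ≡ a + - + 2
    ring = solve-∀

  ¬drop-pairSwap-sameOrder : (π : SignedPerm n) (x y : Elem n) → x ≢ minus y →
    toℤ x < toℤ y → toℤ (inv π x) < toℤ (inv π y) →
    ¬ DropsByOne π (transp x y ∘E transp (minus x) (minus y))
  ¬drop-pairSwap-sameOrder π x y x≢-y x<y gx<gy =
    ¬drop-if-≥ π (transp x y ∘E transp (minus x) (minus y)) (PairSwap.dlen-pairSwap-≥ π x y x<y x≢-y gx<gy)

  ¬drop-pairSwap-sameOrder′ : (π : SignedPerm n) (x y : Elem n) → x ≢ minus y →
    toℤ y < toℤ x → toℤ (inv π y) < toℤ (inv π x) →
    ¬ DropsByOne π (transp x y ∘E transp (minus x) (minus y))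
  ¬drop-pairSwap-sameOrder′ π x y x≢-y y<x gy<gx =
    ¬drop-if-≥ π (transp x y ∘E transp (minus x) (minus y))
      (ℤP.≤-trans (PairSwap.dlen-pairSwap-≥ π y x y<x y≢-x gy<gx) (ℤP.≤-reflexive (dlen-cong swapRoles)))
    where
    y≢-x : y ≢ minus x
    y≢-x e = x≢-y (trans (sym (minus-involutive x)) (cong minus (sym e)))
    swapRoles : ∀ z → transp y x (transp (minus y) (minus x) (fun π z))
                    ≡ transp x y (transp (minus x) (minus y) (fun π z))
    swapRoles z = trans (transp-sym y x (transp (minus y) (minus x) (fun π z)))
                        (cong (transp x y) (transp-sym (minus y) (minus x) (fun π z)))

  sameSign-positive : {u v : Elem n} → SameSign u v → + 0 < toℤ u → + 0 < toℤ v
  sameSign-positive (pp _ _) _ = +<+ (s≤s z≤n)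
  sameSign-positive (nn _ _) ()

  sameSign-minus : {u v : Elem n} → SameSign u (minus v) →
    (toℤ u < + 0 × + 0 < toℤ v) ⊎ (+ 0 < toℤ u × toℤ v < + 0)
  sameSign-minus {v = pos k} (nn _ _) = inj₁ (-<+ , +<+ (s≤s z≤n))
  sameSign-minus {v = neg k} (pp _ _) = inj₂ (+<+ (s≤s z≤n) , -<+)

  module ImageEdges {n : ℕ} (π : SignedPerm n) where
    private
      g : Elem n → Elem n
      g = inv π

    preimage-positive : {x : Elem n} → x ∈Img π → + 0 < toℤ (g x)
    preimage-positive (i , πi≡x) rewrite sym πi≡x | inv-l π (pos i) = +<+ (s≤s z≤n)

    minus-preimage-negative : {x : Elem n} → + 0 < toℤ (g x) → toℤ (g (minus x)) < + 0
    minus-preimage-negative {x} 0<gx rewrite inv-odd π x | toℤ-minus (g x) = ℤP.neg-mono-< 0<gx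

    signEdge-drop : (x : Elem n) → Edge π x (minus x) → DropsByOne π (transp x (minus x))
    signEdge-drop x e with edge-dropsByOne π x (minus x) e
    ... | _ , u-neg _ , drop = drop
    ... | _ , u-same x≢--x _ , _ = ⊥-elim (x≢--x (sym (minus-involutive x)))
    ... | _ , u-preimage x≢--x _ , _ = ⊥-elim (x≢--x (sym (minus-involutive x)))

    signDrop⇒negative : {x : Elem n} → + 0 < toℤ (g x) → DropsByOne π (transp x (minus x)) → toℤ x < + 0
    signDrop⇒negative {x} 0<gx drop with ℤP.<-cmp (toℤ x) (+ 0)
    ... | tri< x<0 _ _ = x<0
    ... | tri≈ _ x≡0 _ = ⊥-elim (toℤ≢0 x x≡0)
    ... | tri> _ _ 0<x = ⊥-elim (¬drop-signSwap-positive π x 0<x 0<gx drop)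

    straddled : (x z : Elem n) → toℤ x < + 0 → + 0 < toℤ (g x) → + 0 < toℤ (g z) →
      toℤ x < toℤ z → toℤ z < toℤ (minus x) → toℤ (g z) < toℤ (g x) →
      ¬ DropsByOne π (transp x (minus x))
    straddled x z x<0 0<gx 0<gz x<z z<-x gz<gx =
      ¬drop-signSwap-straddled π x z x<0 0<gx x<z z<-x -gx<gz gz<gx
      where
      -gx<gz : toℤ (minus (g x)) < toℤ (g z)
      -gx<gz rewrite toℤ-minus (g x) = ℤP.<-trans (ℤP.neg-mono-< 0<gx) 0<gz

    pairDrop-reverses : {x y : Elem n} → x ≢ minus y → x ≢ y →
      DropsByOne π (transp x y ∘E transp (minus x) (minus y)) →
      toℤ x < toℤ y → toℤ (g y) < toℤ (g x)
    pairDrop-reverses {x} {y} x≢-y x≢y drop x<y with ℤP.<-cmp (toℤ (g x)) (toℤ (g y))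
    ... | tri< gx<gy _ _ = ⊥-elim (¬drop-pairSwap-sameOrder π x y x≢-y x<y gx<gy drop)
    ... | tri≈ _ gx≡gy _ = ⊥-elim (x≢y (inv-injective π (toℤ-injective gx≡gy)))
    ... | tri> _ _ gy<gx = gy<gx

    pairDrop-reverses′ : {x y : Elem n} → x ≢ minus y → x ≢ y →
      DropsByOne π (transp x y ∘E transp (minus x) (minus y)) →
      toℤ y < toℤ x → toℤ (g x) < toℤ (g y)
    pairDrop-reverses′ {x} {y} x≢-y x≢y drop y<x with ℤP.<-cmp (toℤ (g x)) (toℤ (g y))
    ... | tri< gx<gy _ _ = gx<gy
    ... | tri≈ _ gx≡gy _ = ⊥-elim (x≢y (inv-injective π (toℤ-injective gx≡gy)))
    ... | tri> _ _ gy<gx = ⊥-elim (¬drop-pairSwap-sameOrder′ π x y x≢-y y<x gy<gx drop)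

  <-minus-flip : (u v : Elem n) → toℤ u < toℤ (minus v) → toℤ v < toℤ (minus u)
  <-minus-flip u v u<-v rewrite toℤ-minus u | toℤ-minus v =
    subst (_< - toℤ u) (ℤP.neg-involutive (toℤ v)) (ℤP.neg-mono-< u<-v)

  <-minus-negative : (u v : Elem n) → toℤ u < + 0 → toℤ v < + 0 → toℤ v < toℤ (minus u)
  <-minus-negative u v u<0 v<0 rewrite toℤ-minus u = ℤP.<-trans v<0 (ℤP.neg-mono-< u<0)

  module TwoImageElements {n : ℕ} (π : SignedPerm n) {a b : Elem n}
    (a∈π : a ∈Img π) (b∈π : b ∈Img π) (a≢b : a ≢ b) where
    open ImageEdges π
    private
      g : Elem n → Elem n
      g = inv π
      0<ga : + 0 < toℤ (g a)
      0<ga = preimage-positive a∈π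
      0<gb : + 0 < toℤ (g b)
      0<gb = preimage-positive b∈π

    edge[a,-a]⇒a<0 : Edge π a (minus a) → toℤ a < + 0
    edge[a,-a]⇒a<0 e = signDrop⇒negative 0<ga (signEdge-drop a e)

    edge[b,-b]⇒b<0 : Edge π b (minus b) → toℤ b < + 0
    edge[b,-b]⇒b<0 e = signDrop⇒negative 0<gb (signEdge-drop b e)

    edge[a,b]-drop : Edge π a b → a ≢ minus b × DropsByOne π (transp a b ∘E transp (minus a) (minus b))
    edge[a,b]-drop e with edge-dropsByOne π a b e
    ... | _ , u-neg b≡-a , _ =
      ⊥-elim (ℤP.<-asym 0<gb (subst (λ w → toℤ (g w) < + 0) (sym b≡-a) (minus-preimage-negative 0<ga)))
    ... | _ , u-same a≢-b _ , drop = a≢-b , drop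
    ... | _ , u-preimage a≢-b _ , drop = a≢-b , drop

    edge[a,b]-reverses : Edge π a b → toℤ a < toℤ b → toℤ (g b) < toℤ (g a)
    edge[a,b]-reverses e with edge[a,b]-drop e
    ... | a≢-b , drop = pairDrop-reverses a≢-b a≢b drop

    edge[a,b]-reverses′ : Edge π a b → toℤ b < toℤ a → toℤ (g a) < toℤ (g b)
    edge[a,b]-reverses′ e with edge[a,b]-drop e
    ... | a≢-b , drop = pairDrop-reverses′ a≢-b a≢b drop

    edge[a,-b]-signs : Edge π a (minus b) →
      ((toℤ a < + 0 × + 0 < toℤ b) ⊎ (+ 0 < toℤ a × toℤ b < + 0)) × toℤ a < toℤ (minus b)
    edge[a,-b]-signs e@(a≢-b , _) with edge-dropsByOne π a (minus b) e
    ... | _ , u-neg -b≡-a , _ = ⊥-elim (a≢b (sym (minus-injective -b≡-a)))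
    ... | _ , u-preimage _ sameSign , _ =
      ⊥-elim (ℤP.<-asym (minus-preimage-negative 0<gb) (sameSign-positive sameSign 0<ga))
    ... | _ , u-same a≢--b sameSign , drop = sameSign-minus sameSign , a<-b
      where
      a<-b : toℤ a < toℤ (minus b)
      a<-b with ℤP.<-cmp (toℤ a) (toℤ (minus b))
      ... | tri< lt _ _ = lt
      ... | tri≈ _ eq _ = ⊥-elim (a≢-b (toℤ-injective eq))
      ... | tri> _ _ -b<a = ⊥-elim (ℤP.<-asym (pairDrop-reverses′ a≢--b a≢-b drop -b<a)
                                              (ℤP.<-trans (minus-preimage-negative 0<gb) 0<ga))

    ¬edges[a,-a][b,-b][a,b] : Edge π a (minus a) → Edge π b (minus b) → Edge π a b → ⊥
    ¬edges[a,-a][b,-b][a,b] ea eb eab with ℤP.<-cmp (toℤ a) (toℤ b)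
    ... | tri< a<b _ _ =
      straddled a b (edge[a,-a]⇒a<0 ea) 0<ga 0<gb a<b
                (<-minus-negative a b (edge[a,-a]⇒a<0 ea) (edge[b,-b]⇒b<0 eb))
                (edge[a,b]-reverses eab a<b) (signEdge-drop a ea)
    ... | tri≈ _ a≡b _ = a≢b (toℤ-injective a≡b)
    ... | tri> _ _ b<a =
      straddled b a (edge[b,-b]⇒b<0 eb) 0<gb 0<ga b<a
                (<-minus-negative b a (edge[b,-b]⇒b<0 eb) (edge[a,-a]⇒a<0 ea))
                (edge[a,b]-reverses′ eab b<a) (signEdge-drop b eb)

    ¬edges[a,-a][b,-b][a,-b] : Edge π a (minus a) → Edge π b (minus b) → Edge π a (minus b) → ⊥
    ¬edges[a,-a][b,-b][a,-b] ea eb e with proj₁ (edge[a,-b]-signs e)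
    ... | inj₁ (_ , 0<b) = ℤP.<-asym 0<b (edge[b,-b]⇒b<0 eb)
    ... | inj₂ (0<a , _) = ℤP.<-asym 0<a (edge[a,-a]⇒a<0 ea)

    ¬edges[a,-a][a,b][a,-b] : Edge π a (minus a) → Edge π a b → Edge π a (minus b) → ⊥
    ¬edges[a,-a][a,b][a,-b] ea eab e with edge[a,-b]-signs e
    ... | inj₂ (0<a , _) , _ = ℤP.<-asym 0<a (edge[a,-a]⇒a<0 ea)
    ... | inj₁ (a<0′ , 0<b) , a<-b =
      straddled a b (edge[a,-a]⇒a<0 ea) 0<ga 0<gb a<b (<-minus-flip a b a<-b)
                (edge[a,b]-reverses eab a<b) (signEdge-drop a ea)
      where
      a<b : toℤ a < toℤ b
      a<b = ℤP.<-trans a<0′ 0<b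

    ¬edges[b,-b][a,b][a,-b] : Edge π b (minus b) → Edge π a b → Edge π a (minus b) → ⊥
    ¬edges[b,-b][a,b][a,-b] eb eab e with edge[a,-b]-signs e
    ... | inj₁ (_ , 0<b) , _ = ℤP.<-asym 0<b (edge[b,-b]⇒b<0 eb)
    ... | inj₂ (0<a , b<0′) , a<-b =
      straddled b a (edge[b,-b]⇒b<0 eb) 0<gb 0<ga b<a a<-b
                (edge[a,b]-reverses′ eab b<a) (signEdge-drop b eb)
      where
      b<a : toℤ b < toℤ a
      b<a = ℤP.<-trans b<0′ 0<a

open import Data.Nat using (_+_; _≤_; z≤n; s≤s)

Indicator : ℕ → Set → Set
Indicator k P = k ≡ 0 ⊎ (k ≡ 1 × P)

at-most-two : {P Q R S : Set} {p q r s : ℕ} →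
  Indicator p P → Indicator q Q → Indicator r R → Indicator s S →
  (P → Q → R → ⊥) → (P → Q → S → ⊥) → (P → R → S → ⊥) → (Q → R → S → ⊥) →
  p + (q + r) + s ≤ 2
at-most-two (inj₂ (refl , P)) (inj₂ (refl , Q)) (inj₂ (refl , R)) _ ¬PQR _ _ _ = ⊥-elim (¬PQR P Q R)
at-most-two (inj₂ (refl , P)) (inj₂ (refl , Q)) _ (inj₂ (refl , S)) _ ¬PQS _ _ = ⊥-elim (¬PQS P Q S)
at-most-two (inj₂ (refl , P)) _ (inj₂ (refl , R)) (inj₂ (refl , S)) _ _ ¬PRS _ = ⊥-elim (¬PRS P R S)
at-most-two _ (inj₂ (refl , Q)) (inj₂ (refl , R)) (inj₂ (refl , S)) _ _ _ ¬QRS = ⊥-elim (¬QRS Q R S)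
at-most-two (inj₁ refl)       (inj₁ refl)       (inj₁ refl)       (inj₁ refl)       _ _ _ _ = z≤n
at-most-two (inj₁ refl)       (inj₁ refl)       (inj₁ refl)       (inj₂ (refl , _)) _ _ _ _ = s≤s z≤n
at-most-two (inj₁ refl)       (inj₁ refl)       (inj₂ (refl , _)) (inj₁ refl)       _ _ _ _ = s≤s z≤n
at-most-two (inj₁ refl)       (inj₁ refl)       (inj₂ (refl , _)) (inj₂ (refl , _)) _ _ _ _ = s≤s (s≤s z≤n)
at-most-two (inj₁ refl)       (inj₂ (refl , _)) (inj₁ refl)       (inj₁ refl)       _ _ _ _ = s≤s z≤n
at-most-two (inj₁ refl)       (inj₂ (refl , _)) (inj₁ refl)       (inj₂ (refl , _)) _ _ _ _ = s≤s (s≤s z≤n)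
at-most-two (inj₁ refl)       (inj₂ (refl , _)) (inj₂ (refl , _)) (inj₁ refl)       _ _ _ _ = s≤s (s≤s z≤n)
at-most-two (inj₂ (refl , _)) (inj₁ refl)       (inj₁ refl)       (inj₁ refl)       _ _ _ _ = s≤s z≤n
at-most-two (inj₂ (refl , _)) (inj₁ refl)       (inj₁ refl)       (inj₂ (refl , _)) _ _ _ _ = s≤s (s≤s z≤n)
at-most-two (inj₂ (refl , _)) (inj₁ refl)       (inj₂ (refl , _)) (inj₁ refl)       _ _ _ _ = s≤s (s≤s z≤n)
at-most-two (inj₂ (refl , _)) (inj₂ (refl , _)) (inj₁ refl)       (inj₁ refl)       _ _ _ _ = s≤s (s≤s z≤n)

eval-indicator : {π : SignedPerm n} {x y : Elem n} {k : ℕ} → EVal π x y k → Indicator k (Edge π x y)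
eval-indicator (e-diag _) = inj₁ refl
eval-indicator (e-adj _ edge) = inj₂ (refl , edge)
eval-indicator (e-non _ _) = inj₁ refl

eval-diagonal : {π : SignedPerm n} {x : Elem n} {k : ℕ} → EVal π x x k → k ≡ 0
eval-diagonal (e-diag _) = refl
eval-diagonal (e-adj x≢x _) = ⊥-elim (x≢x refl)
eval-diagonal (e-non _ _) = refl

mainTheorem5 : (n : ℕ) → 1 ≤ n → (π : SignedPerm n) → (a b : Elem n) →
    a ∈Img π → b ∈Img π → a ≢ b →
    (αaa αab αbb : ℕ) →
    AlphaVal π a a αaa → AlphaVal π a b αab → AlphaVal π b b αbb →
    αaa + αab + αbb ≤ 2
mainTheorem5 n _ π a b a∈π b∈π a≢b .(i + j) .(k + l) .(m + o)
  (i , j , e[a,a] , e[a,-a] , refl) (k , l , e[a,b] , e[a,-b] , refl) (m , o , e[b,b] , e[b,-b] , refl)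
  rewrite eval-diagonal e[a,a] | eval-diagonal e[b,b] =
  at-most-two (eval-indicator e[a,-a]) (eval-indicator e[a,b]) (eval-indicator e[a,-b]) (eval-indicator e[b,-b])
    ¬edges[a,-a][a,b][a,-b]
    (λ P Q S → ¬edges[a,-a][b,-b][a,b] P S Q)
    (λ P R S → ¬edges[a,-a][b,-b][a,-b] P S R)
    (λ Q R S → ¬edges[b,-b][a,b][a,-b] S Q R)
  where open TwoImageElements π a∈π b∈π a≢b
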